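{- Let $n$ be a positive integer with $n\not\equiv 1\pmod 3$. Then the ideal generating function of the numerical semigroup $\langle 3,n+2,2n+1\rangle$ is \[I(3,n+2,2n+1;q)=\frac{1}{1-q^3}\left(1+\frac{q\left(q^{n+1}-1\right)\left(2q^{n+3}+q^2-2q-1\right)-q^4\left(q^{2n+1}-q^{n+1}-q^n+1\right)}{(1-q)^2(1+q)}-q^{2n+2}\right).\]
   Context: $\langle 3,n+2,2n+1\rangle=\{3x+(n+2)y+(2n+1)z: x,y,z\in\mathbb{N}\}$. A non-empty set $I\subseteq S$ is an ideal of the numerical semigroup $S$ if $I+S\subseteq I$; its codimension is $\operatorname{codim}(I)=|S\setminus I|$. The ideal generating function is the formal power series $\sum_I q^{\operatorname{codim}(I)}$ over all ideals $I$ of $S$. -}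

module Defs where

open import Data.Nat as ℕ using (ℕ; zero; suc; _∸_)
open import Data.Bool using (Bool; true; false)
open import Data.Integer as ℤ using (ℤ; +_)
open import Data.Fin using (Fin)
open import Data.List using (List; length)
open import Data.List.Membership.Propositional using (_∈_)
open import Data.List.Relation.Unary.Unique.Propositional using (Unique)
open import Data.Product using (Σ; ∃; ∃-syntax; _×_)
open import Relation.Binary.PropositionalEquality using (_≡_)
open import Relation.Nullary using (Dec; yes; no)
open import Function.Bundles using (_⇔_)

InS : ℕ → ℕ → Set
InS n x = ∃[ a ] ∃[ b ] ∃[ c ]
  (3 ℕ.* a ℕ.+ (n ℕ.+ 2) ℕ.* b ℕ.+ (2 ℕ.* n ℕ.+ 1) ℕ.* c ≡ x)

Subset : Set
Subset = ℕ → Bool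

IsIdeal : ℕ → Subset → Set
IsIdeal n I =
  (∀ x → I x ≡ true → InS n x) ×
  (∃[ x ] I x ≡ true) ×
  (∀ x s → I x ≡ true → InS n s → I (x ℕ.+ s) ≡ true)

Codim : ℕ → Subset → ℕ → Set
Codim n I k = Σ (List ℕ) λ L →
  (length L ≡ k) × Unique L × (∀ x → (x ∈ L) ⇔ (InS n x × I x ≡ false))

IdealCount : ℕ → ℕ → ℕ → Set
IdealCount n k m = Σ (Fin m → Subset) λ f →
  (∀ i → IsIdeal n (f i) × Codim n (f i) k) ×
  (∀ i j → (∀ x → f i x ≡ f j x) → i ≡ j) ×
  (∀ I → IsIdeal n I → Codim n I k → ∃[ i ] (∀ x → I x ≡ f i x))

Series : Set
Series = ℕ → ℤ

infixl 6 _⊕_ _⊖_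
infixl 7 _⊛_

_⊕_ : Series → Series → Series
(f ⊕ g) k = f k ℤ.+ g k

_⊖_ : Series → Series → Series
(f ⊖ g) k = f k ℤ.- g k

Σ≤ : ℕ → (ℕ → ℤ) → ℤ
Σ≤ zero h = h 0
Σ≤ (suc k) h = Σ≤ k h ℤ.+ h (suc k)

_⊛_ : Series → Series → Series
(f ⊛ g) k = Σ≤ k (λ i → f i ℤ.* g (k ∸ i))

cst : ℤ → Series
cst c zero = c
cst c (suc k) = + 0

q^ : ℕ → Series
q^ e k with k ℕ.≟ e
... | yes _ = + 1
... | no _ = + 0

infix 4 _≈ₛ_
_≈ₛ_ : Series → Series → Set
f ≈ₛ g = ∀ k → f k ≡ g k

numer : ℕ → Series
numer n =
  q^ 1 ⊛ (q^ (n ℕ.+ 1) ⊖ cst (+ 1))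
       ⊛ (cst (+ 2) ⊛ q^ (n ℕ.+ 3) ⊕ q^ 2 ⊖ cst (+ 2) ⊛ q^ 1 ⊖ cst (+ 1))
  ⊖ q^ 4 ⊛ (q^ (2 ℕ.* n ℕ.+ 1) ⊖ q^ (n ℕ.+ 1) ⊖ q^ n ⊕ cst (+ 1))

denom : Series
denom = (cst (+ 1) ⊖ q^ 1) ⊛ (cst (+ 1) ⊖ q^ 1) ⊛ (cst (+ 1) ⊕ q^ 1)

-- Since n ≢ 1 (mod 3), the Apéry set of S = ⟨3, n+2, 2n+1⟩ with respect to 3 is {0, n+2, 2n+1}: one
-- element in each residue class mod 3, so S is the disjoint union of the progressions w + 3ℕ. An ideal
-- is therefore determined by the index (u, v, w) at which it enters each progression; closure under
-- adding n+2 and 2n+1 becomes six linear inequalities between u, v, w, and the codimension is u+v+w.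
-- Every admissible triple is a unique translate of one of finitely many base triples by (j, j, j),
-- so (1 − q³) I(q) is the polynomial P(q) = Σ q^(size of base). Summing the bases row by row writes
-- P as a sum of geometric progressions, which (1 − q)²(1 + q) telescopes to the stated numerator.

module Submission where

open import Defs
open import Data.Nat using (ℕ; _≤_; _%_; _*_; _+_)
open import Data.Integer using () renaming (+_ to ⁺_)
open import Data.Product using (Σ; ∃-syntax; _×_)
open import Relation.Binary.PropositionalEquality using (_≡_; _≢_)

open import Data.Nat using (zero; suc; pred; _∸_; _⊓_; _<_; _≤ᵇ_; _≟_; _≤?_; s≤s; z≤n)
import Data.Nat.Properties as ℕ
open import Data.Nat.DivMod using (_/_; m≡m%n+[m/n]*n; m%n<n; [m+kn]%n≡m%n; m<n⇒m%n≡m)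
open import Data.Nat.Tactic.RingSolver using (solve-∀; solve)
open import Data.Integer using (ℤ) renaming (_+_ to _+ᶻ_; _-_ to _-ᶻ_; _*_ to _*ᶻ_; -_ to negᶻ)
import Data.Integer.Properties as ℤ
open import Data.Integer.Tactic.RingSolver using () renaming (solve-∀ to solve-∀ᶻ; solve to solveᶻ)
open import Algebra.Properties.CommutativeSemigroup ℤ.+-commutativeSemigroup using (interchange)
open import Data.Bool using (Bool; true; false)
open import Data.Bool.Properties using (T-≡)
open import Data.Unit using (⊤; tt)
open import Data.Empty using (⊥; ⊥-elim)
open import Data.Sum using (_⊎_; inj₁; inj₂) renaming ([_,_] to either)
open import Data.Product using (∃; _,_; proj₁; proj₂)
open import Data.Maybe using (Maybe; just; nothing; maybe)
import Data.Maybe as Maybe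
open import Data.Maybe.Properties using (just-injective)
open import Data.Fin using (Fin)
open import Data.List using (List; []; _∷_; _++_; [_]; map; concatMap; downFrom; length; lookup)
import Data.List.Properties as List
open import Data.List.Membership.Propositional using (_∈_; find; lose)
open import Data.List.Membership.Propositional.Properties
  using (∈-++⁻; ∈-++⁺ˡ; ∈-++⁺ʳ; ∈-map⁻; ∈-map⁺; ∈-downFrom⁺; ∈-downFrom⁻; ∈-concatMap⁻; ∈-concatMap⁺; ∈-lookup)
open import Data.List.Membership.Propositional.Properties.WithK using (unique∧set⇒bag)
open import Data.List.Relation.Unary.All as All using ()
open import Data.List.Relation.Unary.AllPairs using ([]; _∷_)
open import Data.List.Relation.Unary.Any using (here; there; index)
open import Data.List.Relation.Unary.Any.Properties using (lookup-index)
open import Data.List.Relation.Unary.Unique.Propositional using (Unique)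
import Data.List.Relation.Unary.Unique.Propositional.Properties as Unique
open import Data.List.Relation.Binary.BagAndSetEquality using (∼bag⇒↭)
open import Data.List.Relation.Binary.Permutation.Propositional.Properties using (↭-length)
open import Function using (_∘_; _∋_)
open import Function.Bundles using (_⇔_; mk⇔; Equivalence)
open import Relation.Nullary using (¬_; Dec; yes; no)
open import Relation.Binary.PropositionalEquality using (refl; sym; trans; cong; cong₂; subst; _→-setoid_; module ≡-Reasoning)
import Relation.Binary.Reasoning.Setoid as SetoidReasoning

module _ {A B : Set} where

  concatMap-unique : (f : A → List B) (key : B → A) {xs : List A} → Unique xs →
    (∀ x → Unique (f x)) → (∀ {x y} → x ∈ xs → y ∈ f x → key y ≡ x) →
    Unique (concatMap f xs)
  concatMap-unique f key {[]} _ _ _ = []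
  concatMap-unique f key {x ∷ xs} (x∉xs ∷ xs!) f! key-inv =
    Unique.++⁺ (f! x) (concatMap-unique f key xs! f! (key-inv ∘ there)) disjoint
    where
    disjoint : ∀ {y} → y ∈ f x × y ∈ concatMap f xs → ⊥
    disjoint (y∈fx , y∈rest) with find (∈-concatMap⁻ f {xs = xs} y∈rest)
    ... | x′ , x′∈xs , y∈fx′ =
      All.lookup x∉xs x′∈xs (trans (sym (key-inv (here refl) y∈fx)) (key-inv (there x′∈xs) y∈fx′))

module _ {A : Set} where

  lookup-injective : {xs : List A} → Unique xs → ∀ i j → lookup xs i ≡ lookup xs j → i ≡ j
  lookup-injective {_ ∷ _} _ Fin.zero Fin.zero _ = refl
  lookup-injective {_ ∷ xs} (x∉xs ∷ _) Fin.zero (Fin.suc j) eq =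
    ⊥-elim (All.lookup x∉xs (∈-lookup {xs = xs} j) eq)
  lookup-injective {_ ∷ xs} (x∉xs ∷ _) (Fin.suc i) Fin.zero eq =
    ⊥-elim (All.lookup x∉xs (∈-lookup {xs = xs} i) (sym eq))
  lookup-injective {_ ∷ _} (_ ∷ xs!) (Fin.suc i) (Fin.suc j) eq =
    cong Fin.suc (lookup-injective xs! i j eq)

  unique-same-members⇒same-length : {xs ys : List A} → Unique xs → Unique ys →
    (∀ z → (z ∈ xs) ⇔ (z ∈ ys)) → length xs ≡ length ys
  unique-same-members⇒same-length xs! ys! same =
    ↭-length (∼bag⇒↭ (unique∧set⇒bag xs! ys! (λ {z} → same z)))

≤ᵇ-true⇒≤ : ∀ {m j} → (m ≤ᵇ j) ≡ true → m ≤ j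
≤ᵇ-true⇒≤ {m} {j} eq = ℕ.≤ᵇ⇒≤ m j (Equivalence.from T-≡ eq)

≤⇒≤ᵇ-true : ∀ {m j} → m ≤ j → (m ≤ᵇ j) ≡ true
≤⇒≤ᵇ-true m≤j = Equivalence.to T-≡ (ℕ.≤⇒≤ᵇ m≤j)

≰⇒≤ᵇ-false : ∀ {m j} → ¬ m ≤ j → (m ≤ᵇ j) ≡ false
≰⇒≤ᵇ-false {m} {j} m≰j with m ≤ᵇ j in eq
... | true = ⊥-elim (m≰j (≤ᵇ-true⇒≤ eq))
... | false = refl

Least : (ℕ → Bool) → ℕ → Set
Least P m = P m ≡ true × (∀ {i} → i < m → P i ≡ false)

least : (P : ℕ → Bool) → ∃[ j ] P j ≡ true → Σ ℕ (Least P)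
least P (j , Pj) with search j
  where
  search : ∀ N → Σ ℕ (Least P) ⊎ (∀ {i} → i ≤ N → P i ≡ false)
  search zero with P 0 in P0
  ... | true = inj₁ (0 , P0 , λ ())
  ... | false = inj₂ λ { z≤n → P0 }
  search (suc N) with search N
  ... | inj₁ found = inj₁ found
  ... | inj₂ none with P (suc N) in PN
  ...   | true = inj₁ (suc N , PN , λ i<1+N → none (ℕ.≤-pred i<1+N))
  ...   | false = inj₂ λ i≤1+N → either (λ i<1+N → none (ℕ.≤-pred i<1+N)) (λ { refl → PN }) (ℕ.m≤n⇒m<n∨m≡n i≤1+N)
... | inj₁ found = found
... | inj₂ none with () ← trans (sym Pj) (none ℕ.≤-refl)

module SeriesReasoning = SetoidReasoning (ℕ →-setoid ℤ)

0ₛ : Series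
0ₛ _ = ⁺ 0

≈ₛ-refl : ∀ f → f ≈ₛ f
≈ₛ-refl f k = refl

⊕-cong : ∀ {f f′ g g′} → f ≈ₛ f′ → g ≈ₛ g′ → f ⊕ g ≈ₛ f′ ⊕ g′
⊕-cong f≈ g≈ k = cong₂ _+ᶻ_ (f≈ k) (g≈ k)

⊖-cong : ∀ {f f′ g g′} → f ≈ₛ f′ → g ≈ₛ g′ → f ⊖ g ≈ₛ f′ ⊖ g′
⊖-cong f≈ g≈ k = cong₂ _-ᶻ_ (f≈ k) (g≈ k)

Σ≤-cong : ∀ k {f g : ℕ → ℤ} → (∀ i → f i ≡ g i) → Σ≤ k f ≡ Σ≤ k g
Σ≤-cong zero f≗g = f≗g 0
Σ≤-cong (suc k) f≗g = cong₂ _+ᶻ_ (Σ≤-cong k f≗g) (f≗g (suc k))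

Σ≤-+ : ∀ k (f g : ℕ → ℤ) → Σ≤ k (λ i → f i +ᶻ g i) ≡ Σ≤ k f +ᶻ Σ≤ k g
Σ≤-+ zero f g = refl
Σ≤-+ (suc k) f g =
  trans (cong (_+ᶻ (f (suc k) +ᶻ g (suc k))) (Σ≤-+ k f g)) (interchange (Σ≤ k f) (Σ≤ k g) (f (suc k)) (g (suc k)))

Σ≤-neg : ∀ k (f : ℕ → ℤ) → Σ≤ k (λ i → negᶻ (f i)) ≡ negᶻ (Σ≤ k f)
Σ≤-neg zero f = refl
Σ≤-neg (suc k) f =
  trans (cong (_+ᶻ negᶻ (f (suc k))) (Σ≤-neg k f)) (sym (ℤ.neg-distrib-+ (Σ≤ k f) (f (suc k))))

Σ≤-- : ∀ k (f g : ℕ → ℤ) → Σ≤ k (λ i → f i -ᶻ g i) ≡ Σ≤ k f -ᶻ Σ≤ k g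
Σ≤-- k f g = trans (Σ≤-+ k f (λ i → negᶻ (g i))) (cong (Σ≤ k f +ᶻ_) (Σ≤-neg k g))

Σ≤-zero : ∀ k → Σ≤ k (λ _ → ⁺ 0) ≡ ⁺ 0
Σ≤-zero zero = refl
Σ≤-zero (suc k) = trans (ℤ.+-identityʳ _) (Σ≤-zero k)

Σ≤-peel : ∀ k (f : ℕ → ℤ) → Σ≤ (suc k) f ≡ f 0 +ᶻ Σ≤ k (f ∘ suc)
Σ≤-peel zero f = refl
Σ≤-peel (suc k) f = trans (cong (_+ᶻ f (suc (suc k))) (Σ≤-peel k f)) (ℤ.+-assoc (f 0) _ _)

⊛-congˡ : ∀ {f f′} g → f ≈ₛ f′ → f ⊛ g ≈ₛ f′ ⊛ g
⊛-congˡ g f≈ k = Σ≤-cong k (λ i → cong (_*ᶻ g (k ∸ i)) (f≈ i))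

⊛-congʳ : ∀ f {g g′} → g ≈ₛ g′ → f ⊛ g ≈ₛ f ⊛ g′
⊛-congʳ f g≈ k = Σ≤-cong k (λ i → cong (f i *ᶻ_) (g≈ (k ∸ i)))

⊛-distribʳ-⊕ : ∀ f g h → (f ⊕ g) ⊛ h ≈ₛ f ⊛ h ⊕ g ⊛ h
⊛-distribʳ-⊕ f g h k =
  trans (Σ≤-cong k (λ i → ℤ.*-distribʳ-+ (h (k ∸ i)) (f i) (g i))) (Σ≤-+ k _ _)

⊛-distribʳ-⊖ : ∀ f g h → (f ⊖ g) ⊛ h ≈ₛ f ⊛ h ⊖ g ⊛ h
⊛-distribʳ-⊖ f g h k = trans (Σ≤-cong k (λ i → *-distribʳ-- (h (k ∸ i)) (f i) (g i))) (Σ≤-- k _ _)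
  where
  *-distribʳ-- : ∀ c a b → (a -ᶻ b) *ᶻ c ≡ a *ᶻ c -ᶻ b *ᶻ c
  *-distribʳ-- c a b =
    trans (ℤ.*-distribʳ-+ c a (negᶻ b)) (cong (a *ᶻ c +ᶻ_) (sym (ℤ.neg-distribˡ-* b c)))

cst-⊛ : ∀ c f → cst c ⊛ f ≈ₛ (λ k → c *ᶻ f k)
cst-⊛ c f zero = refl
cst-⊛ c f (suc k) = begin
  Σ≤ (suc k) (λ i → cst c i *ᶻ f (suc k ∸ i))  ≡⟨ Σ≤-peel k _ ⟩
  c *ᶻ f (suc k) +ᶻ Σ≤ k (λ _ → ⁺ 0)           ≡⟨ cong (c *ᶻ f (suc k) +ᶻ_) (Σ≤-zero k) ⟩
  c *ᶻ f (suc k) +ᶻ ⁺ 0                         ≡⟨ ℤ.+-identityʳ _ ⟩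
  c *ᶻ f (suc k)                                ∎
  where open ≡-Reasoning

one-⊛ : ∀ f → cst (⁺ 1) ⊛ f ≈ₛ f
one-⊛ f k = trans (cst-⊛ (⁺ 1) f k) (ℤ.*-identityˡ (f k))

shift : Series → Series
shift f zero = ⁺ 0
shift f (suc k) = f k

shiftⁿ : ℕ → Series → Series
shiftⁿ zero f = f
shiftⁿ (suc e) f = shift (shiftⁿ e f)

shift-cong : ∀ {f g} → f ≈ₛ g → shift f ≈ₛ shift g
shift-cong f≈g zero = refl
shift-cong f≈g (suc k) = f≈g k

shiftⁿ-cong : ∀ e {f g} → f ≈ₛ g → shiftⁿ e f ≈ₛ shiftⁿ e g
shiftⁿ-cong zero f≈g = f≈g
shiftⁿ-cong (suc e) f≈g = shift-cong (shiftⁿ-cong e f≈g)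

shiftⁿ-⊕ : ∀ e f g → shiftⁿ e (f ⊕ g) ≈ₛ shiftⁿ e f ⊕ shiftⁿ e g
shiftⁿ-⊕ zero f g k = refl
shiftⁿ-⊕ (suc e) f g zero = refl
shiftⁿ-⊕ (suc e) f g (suc k) = shiftⁿ-⊕ e f g k

shiftⁿ-⊖ : ∀ e f g → shiftⁿ e (f ⊖ g) ≈ₛ shiftⁿ e f ⊖ shiftⁿ e g
shiftⁿ-⊖ zero f g k = refl
shiftⁿ-⊖ (suc e) f g zero = refl
shiftⁿ-⊖ (suc e) f g (suc k) = shiftⁿ-⊖ e f g k

shiftⁿ-scale : ∀ e c f → shiftⁿ e (λ k → c *ᶻ f k) ≈ₛ (λ k → c *ᶻ shiftⁿ e f k)
shiftⁿ-scale zero c f k = refl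
shiftⁿ-scale (suc e) c f zero = sym (ℤ.*-zeroʳ c)
shiftⁿ-scale (suc e) c f (suc k) = shiftⁿ-scale e c f k

shiftⁿ-0ₛ : ∀ e → shiftⁿ e 0ₛ ≈ₛ 0ₛ
shiftⁿ-0ₛ zero k = refl
shiftⁿ-0ₛ (suc e) zero = refl
shiftⁿ-0ₛ (suc e) (suc k) = shiftⁿ-0ₛ e k

shift-⊛ : ∀ f g → shift f ⊛ g ≈ₛ shift (f ⊛ g)
shift-⊛ f g zero = refl
shift-⊛ f g (suc k) = trans (Σ≤-peel k _) (ℤ.+-identityˡ _)

q^-cong : ∀ {e e′} → e ≡ e′ → q^ e ≈ₛ q^ e′
q^-cong refl k = refl

q^-self : ∀ e → q^ e e ≡ ⁺ 1
q^-self e with e ≟ e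
... | yes _ = refl
... | no e≢e = ⊥-elim (e≢e refl)

q^-other : ∀ {e k} → k ≢ e → q^ e k ≡ ⁺ 0
q^-other {e} {k} k≢e with k ≟ e
... | yes k≡e = ⊥-elim (k≢e k≡e)
... | no _ = refl

q^-zero : q^ 0 ≈ₛ cst (⁺ 1)
q^-zero zero = refl
q^-zero (suc k) = refl

q^-suc : ∀ e → q^ (suc e) ≈ₛ shift (q^ e)
q^-suc e zero = refl
q^-suc e (suc k) = by-cases (k ≟ e)
  where
  by-cases : Dec (k ≡ e) → q^ (suc e) (suc k) ≡ q^ e k
  by-cases (yes refl) = trans (q^-self (suc k)) (sym (q^-self k))
  by-cases (no k≢e) = trans (q^-other (k≢e ∘ ℕ.suc-injective)) (sym (q^-other k≢e))

q^-⊛ : ∀ e f → q^ e ⊛ f ≈ₛ shiftⁿ e f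
q^-⊛ zero f k = trans (⊛-congˡ f q^-zero k) (one-⊛ f k)
q^-⊛ (suc e) f k =
  trans (⊛-congˡ f (q^-suc e) k) (trans (shift-⊛ (q^ e) f k) (shift-cong (q^-⊛ e f) k))

shiftⁿ-q^ : ∀ m e → shiftⁿ m (q^ e) ≈ₛ q^ (m + e)
shiftⁿ-q^ zero e k = refl
shiftⁿ-q^ (suc m) e k = trans (shift-cong (shiftⁿ-q^ m e) k) (sym (q^-suc (m + e) k))

⟦_⟧ : List (ℤ × ℕ) → Series
⟦ [] ⟧ = 0ₛ
⟦ (c , e) ∷ p ⟧ = (λ k → c *ᶻ q^ e k) ⊕ ⟦ p ⟧

raise : ℕ → List (ℤ × ℕ) → List (ℤ × ℕ)
raise m = map (λ (c , e) → c , m + e)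

shiftⁿ-⟦⟧ : ∀ m p → shiftⁿ m ⟦ p ⟧ ≈ₛ ⟦ raise m p ⟧
shiftⁿ-⟦⟧ m [] = shiftⁿ-0ₛ m
shiftⁿ-⟦⟧ m ((c , e) ∷ p) k = begin
  shiftⁿ m ((λ k → c *ᶻ q^ e k) ⊕ ⟦ p ⟧) k                 ≡⟨ shiftⁿ-⊕ m _ ⟦ p ⟧ k ⟩
  shiftⁿ m (λ k → c *ᶻ q^ e k) k +ᶻ shiftⁿ m ⟦ p ⟧ k      ≡⟨ cong₂ _+ᶻ_ (shiftⁿ-scale m c (q^ e) k) (shiftⁿ-⟦⟧ m p k) ⟩
  c *ᶻ shiftⁿ m (q^ e) k +ᶻ ⟦ raise m p ⟧ k               ≡⟨ cong (λ x → c *ᶻ x +ᶻ ⟦ raise m p ⟧ k) (shiftⁿ-q^ m e k) ⟩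
  c *ᶻ q^ (m + e) k +ᶻ ⟦ raise m p ⟧ k                    ∎
  where open ≡-Reasoning

-- Multiplication by the denominator (1 − q)²(1 + q) = 1 − q − q² + q³

Λ : Series → Series
Λ f = f ⊖ shift f ⊖ shiftⁿ 2 f ⊕ shiftⁿ 3 f

oneMinusQ-⊛ : ∀ f → (cst (⁺ 1) ⊖ q^ 1) ⊛ f ≈ₛ f ⊖ shift f
oneMinusQ-⊛ f k = trans (⊛-distribʳ-⊖ (cst (⁺ 1)) (q^ 1) f k) (cong₂ _-ᶻ_ (one-⊛ f k) (q^-⊛ 1 f k))

denom-coefficients : denom ≈ₛ cst (⁺ 1) ⊖ q^ 1 ⊖ q^ 2 ⊕ q^ 3
denom-coefficients = begin
  X ⊛ X ⊛ Y                              ≈⟨ ⊛-congˡ Y (oneMinusQ-⊛ X) ⟩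
  (X ⊖ shift X) ⊛ Y                      ≈⟨ ⊛-distribʳ-⊖ X (shift X) Y ⟩
  X ⊛ Y ⊖ shift X ⊛ Y                    ≈⟨ ⊖-cong (oneMinusQ-⊛ Y) (λ k → trans (shift-⊛ X Y k) (shift-cong (oneMinusQ-⊛ Y) k)) ⟩
  (Y ⊖ shift Y) ⊖ shift (Y ⊖ shift Y)    ≈⟨ coefficients ⟩
  cst (⁺ 1) ⊖ q^ 1 ⊖ q^ 2 ⊕ q^ 3         ∎
  where
  open SeriesReasoning
  X Y : Series
  X = cst (⁺ 1) ⊖ q^ 1
  Y = cst (⁺ 1) ⊕ q^ 1
  coefficients : (Y ⊖ shift Y) ⊖ shift (Y ⊖ shift Y) ≈ₛ cst (⁺ 1) ⊖ q^ 1 ⊖ q^ 2 ⊕ q^ 3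
  coefficients zero = refl
  coefficients (suc zero) = refl
  coefficients (suc (suc zero)) = refl
  coefficients (suc (suc (suc zero))) = refl
  coefficients (suc (suc (suc (suc k)))) = refl

denom-⊛ : ∀ f → denom ⊛ f ≈ₛ Λ f
denom-⊛ f = begin
  denom ⊛ f                                          ≈⟨ ⊛-congˡ f denom-coefficients ⟩
  (cst (⁺ 1) ⊖ q^ 1 ⊖ q^ 2 ⊕ q^ 3) ⊛ f               ≈⟨ ⊛-distribʳ-⊕ (cst (⁺ 1) ⊖ q^ 1 ⊖ q^ 2) (q^ 3) f ⟩
  (cst (⁺ 1) ⊖ q^ 1 ⊖ q^ 2) ⊛ f ⊕ q^ 3 ⊛ f          ≈⟨ ⊕-cong (⊛-distribʳ-⊖ (cst (⁺ 1) ⊖ q^ 1) (q^ 2) f) (q^-⊛ 3 f) ⟩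
  ((cst (⁺ 1) ⊖ q^ 1) ⊛ f ⊖ q^ 2 ⊛ f) ⊕ shiftⁿ 3 f  ≈⟨ ⊕-cong (⊖-cong (oneMinusQ-⊛ f) (q^-⊛ 2 f)) (≈ₛ-refl (shiftⁿ 3 f)) ⟩
  Λ f                                                ∎
  where open SeriesReasoning

Λ-cong : ∀ {f g} → f ≈ₛ g → Λ f ≈ₛ Λ g
Λ-cong f≈g = ⊕-cong (⊖-cong (⊖-cong f≈g (shift-cong f≈g)) (shiftⁿ-cong 2 f≈g)) (shiftⁿ-cong 3 f≈g)

Λ-⊕ : ∀ f g → Λ (f ⊕ g) ≈ₛ Λ f ⊕ Λ g
Λ-⊕ f g k = trans
  (cong₂ _+ᶻ_ (cong₂ _-ᶻ_ (cong ((f ⊕ g) k -ᶻ_) (shiftⁿ-⊕ 1 f g k)) (shiftⁿ-⊕ 2 f g k)) (shiftⁿ-⊕ 3 f g k))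
  (rearrange (f k) (shift f k) (shiftⁿ 2 f k) (shiftⁿ 3 f k) (g k) (shift g k) (shiftⁿ 2 g k) (shiftⁿ 3 g k))
  where
  rearrange : ∀ a b c d a′ b′ c′ d′ →
    (a +ᶻ a′) -ᶻ (b +ᶻ b′) -ᶻ (c +ᶻ c′) +ᶻ (d +ᶻ d′) ≡ (a -ᶻ b -ᶻ c +ᶻ d) +ᶻ (a′ -ᶻ b′ -ᶻ c′ +ᶻ d′)
  rearrange = solve-∀ᶻ

Λ-⊖ : ∀ f g → Λ (f ⊖ g) ≈ₛ Λ f ⊖ Λ g
Λ-⊖ f g k = trans
  (cong₂ _+ᶻ_ (cong₂ _-ᶻ_ (cong ((f ⊖ g) k -ᶻ_) (shiftⁿ-⊖ 1 f g k)) (shiftⁿ-⊖ 2 f g k)) (shiftⁿ-⊖ 3 f g k))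
  (rearrange (f k) (shift f k) (shiftⁿ 2 f k) (shiftⁿ 3 f k) (g k) (shift g k) (shiftⁿ 2 g k) (shiftⁿ 3 g k))
  where
  rearrange : ∀ a b c d a′ b′ c′ d′ →
    (a -ᶻ a′) -ᶻ (b -ᶻ b′) -ᶻ (c -ᶻ c′) +ᶻ (d -ᶻ d′) ≡ (a -ᶻ b -ᶻ c +ᶻ d) -ᶻ (a′ -ᶻ b′ -ᶻ c′ +ᶻ d′)
  rearrange = solve-∀ᶻ

Λ-0ₛ : Λ 0ₛ ≈ₛ 0ₛ
Λ-0ₛ zero = refl
Λ-0ₛ (suc zero) = refl
Λ-0ₛ (suc (suc zero)) = refl
Λ-0ₛ (suc (suc (suc k))) = refl

Λ-q^ : ∀ e → Λ (q^ e) ≈ₛ q^ e ⊖ q^ (1 + e) ⊖ q^ (2 + e) ⊕ q^ (3 + e)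
Λ-q^ e = ⊕-cong (⊖-cong (⊖-cong (≈ₛ-refl (q^ e)) (shiftⁿ-q^ 1 e)) (shiftⁿ-q^ 2 e)) (shiftⁿ-q^ 3 e)

geom : ℕ → ℕ → Series
geom r zero = 0ₛ
geom r (suc m) = q^ (r + m) ⊕ geom r m

Λ-geom : ∀ r m → Λ (geom r m) ≈ₛ q^ r ⊖ q^ (2 + r) ⊖ q^ (r + m) ⊕ q^ (2 + (r + m))
Λ-geom r zero = begin
  Λ 0ₛ                                                     ≈⟨ Λ-0ₛ ⟩
  0ₛ                                                       ≈⟨ cancel ⟩
  q^ r ⊖ q^ (2 + r) ⊖ q^ r ⊕ q^ (2 + r)                   ≈⟨ ⊕-cong (⊖-cong (≈ₛ-refl (q^ r ⊖ q^ (2 + r))) (q^-cong r≡r+0)) (q^-cong (cong (2 +_) r≡r+0)) ⟩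
  q^ r ⊖ q^ (2 + r) ⊖ q^ (r + 0) ⊕ q^ (2 + (r + 0))       ∎
  where
  open SeriesReasoning
  r≡r+0 : r ≡ r + 0
  r≡r+0 = sym (ℕ.+-identityʳ r)
  cancel : 0ₛ ≈ₛ q^ r ⊖ q^ (2 + r) ⊖ q^ r ⊕ q^ (2 + r)
  cancel k with q^ r k | q^ (2 + r) k
  ... | a | b = solveᶻ (a ∷ b ∷ [])
Λ-geom r (suc m) = begin
  Λ (q^ (r + m) ⊕ geom r m)                                             ≈⟨ Λ-⊕ (q^ (r + m)) (geom r m) ⟩
  Λ (q^ (r + m)) ⊕ Λ (geom r m)                                         ≈⟨ ⊕-cong (Λ-q^ (r + m)) (Λ-geom r m) ⟩
  (q^ (r + m) ⊖ q^ (1 + (r + m)) ⊖ q^ (2 + (r + m)) ⊕ q^ (3 + (r + m)))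
    ⊕ (q^ r ⊖ q^ (2 + r) ⊖ q^ (r + m) ⊕ q^ (2 + (r + m)))               ≈⟨ telescope ⟩
  q^ r ⊖ q^ (2 + r) ⊖ q^ (1 + (r + m)) ⊕ q^ (3 + (r + m))               ≈⟨ ⊕-cong (⊖-cong (≈ₛ-refl (q^ r ⊖ q^ (2 + r))) (q^-cong r+1+m)) (q^-cong (cong (2 +_) r+1+m)) ⟩
  q^ r ⊖ q^ (2 + r) ⊖ q^ (r + suc m) ⊕ q^ (2 + (r + suc m))             ∎
  where
  open SeriesReasoning
  r+1+m : suc (r + m) ≡ r + suc m
  r+1+m = sym (ℕ.+-suc r m)
  telescope : (q^ (r + m) ⊖ q^ (1 + (r + m)) ⊖ q^ (2 + (r + m)) ⊕ q^ (3 + (r + m)))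
                ⊕ (q^ r ⊖ q^ (2 + r) ⊖ q^ (r + m) ⊕ q^ (2 + (r + m)))
              ≈ₛ q^ r ⊖ q^ (2 + r) ⊖ q^ (1 + (r + m)) ⊕ q^ (3 + (r + m))
  telescope k with q^ r k | q^ (2 + r) k | q^ (r + m) k | q^ (1 + (r + m)) k | q^ (2 + (r + m)) k | q^ (3 + (r + m)) k
  ... | a | b | c | d | e | f = solveᶻ (a ∷ b ∷ c ∷ d ∷ e ∷ f ∷ [])

triangle : ℕ → Series
triangle zero = 0ₛ
triangle (suc m) = geom m (suc m) ⊕ triangle m

Λ-triangle : ∀ m → Λ (triangle m) ≈ₛ q^ 0 ⊖ q^ m ⊖ q^ (suc m) ⊕ q^ (suc (m + m))
Λ-triangle zero = λ k → trans (Λ-0ₛ k) (cancel k)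
  where
  cancel : 0ₛ ≈ₛ q^ 0 ⊖ q^ 0 ⊖ q^ 1 ⊕ q^ 1
  cancel k with q^ 0 k | q^ 1 k
  ... | a | b = solveᶻ (a ∷ b ∷ [])
Λ-triangle (suc m) = begin
  Λ (geom m (suc m) ⊕ triangle m)                                       ≈⟨ Λ-⊕ (geom m (suc m)) (triangle m) ⟩
  Λ (geom m (suc m)) ⊕ Λ (triangle m)                                   ≈⟨ ⊕-cong (Λ-geom m (suc m)) (Λ-triangle m) ⟩
  (q^ m ⊖ q^ (2 + m) ⊖ q^ (m + suc m) ⊕ q^ (2 + (m + suc m)))
    ⊕ (q^ 0 ⊖ q^ m ⊖ q^ (suc m) ⊕ q^ (suc (m + m)))                    ≈⟨ ⊕-cong (⊕-cong (⊖-cong (≈ₛ-refl (q^ m ⊖ q^ (2 + m))) (q^-cong m+1+m))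
                                                                                          (q^-cong (cong (2 +_) m+1+m)))
                                                                                  (≈ₛ-refl (q^ 0 ⊖ q^ m ⊖ q^ (suc m) ⊕ q^ (suc (m + m)))) ⟩
  (q^ m ⊖ q^ (2 + m) ⊖ q^ (1 + (m + m)) ⊕ q^ (3 + (m + m)))
    ⊕ (q^ 0 ⊖ q^ m ⊖ q^ (suc m) ⊕ q^ (suc (m + m)))                    ≈⟨ telescope ⟩
  q^ 0 ⊖ q^ (1 + m) ⊖ q^ (2 + m) ⊕ q^ (3 + (m + m))                     ≈⟨ ⊕-cong (≈ₛ-refl (q^ 0 ⊖ q^ (1 + m) ⊖ q^ (2 + m))) (q^-cong (cong (2 +_) (sym m+1+m))) ⟩
  q^ 0 ⊖ q^ (suc m) ⊖ q^ (suc (suc m)) ⊕ q^ (suc (suc m + suc m))       ∎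
  where
  open SeriesReasoning
  m+1+m : m + suc m ≡ suc (m + m)
  m+1+m = ℕ.+-suc m m
  telescope : (q^ m ⊖ q^ (2 + m) ⊖ q^ (1 + (m + m)) ⊕ q^ (3 + (m + m)))
                ⊕ (q^ 0 ⊖ q^ m ⊖ q^ (suc m) ⊕ q^ (suc (m + m)))
              ≈ₛ q^ 0 ⊖ q^ (1 + m) ⊖ q^ (2 + m) ⊕ q^ (3 + (m + m))
  telescope k with q^ 0 k | q^ m k | q^ (1 + m) k | q^ (2 + m) k | q^ (1 + (m + m)) k | q^ (3 + (m + m)) k
  ... | a | b | c | d | e | f = solveᶻ (a ∷ b ∷ c ∷ d ∷ e ∷ f ∷ [])

module _ (n : ℕ) where

  private
    Y Z : Series
    Y = cst (⁺ 2) ⊛ q^ (n + 3) ⊕ q^ 2 ⊖ cst (⁺ 2) ⊛ q^ 1 ⊖ cst (⁺ 1)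
    Z = q^ (2 * n + 1) ⊖ q^ (n + 1) ⊖ q^ n ⊕ cst (⁺ 1)

    y z : List (ℤ × ℕ)
    y = (⁺ 2 , 3 + n) ∷ (⁺ 1 , 2) ∷ (negᶻ (⁺ 2) , 1) ∷ (negᶻ (⁺ 1) , 0) ∷ []
    z = (⁺ 1 , n + suc n) ∷ (negᶻ (⁺ 1) , suc n) ∷ (negᶻ (⁺ 1) , n) ∷ (⁺ 1 , 0) ∷ []

    Y≈y : Y ≈ₛ ⟦ y ⟧
    Y≈y k rewrite cst-⊛ (⁺ 2) (q^ (n + 3)) k | cst-⊛ (⁺ 2) (q^ 1) k | ℕ.+-comm n 3 | q^-zero k =
      expand (q^ (3 + n) k) (q^ 2 k) (q^ 1 k) (cst (⁺ 1) k)
      where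
      expand : ∀ a b c d → ⁺ 2 *ᶻ a +ᶻ b -ᶻ ⁺ 2 *ᶻ c -ᶻ d
                           ≡ ⁺ 2 *ᶻ a +ᶻ (⁺ 1 *ᶻ b +ᶻ (negᶻ (⁺ 2) *ᶻ c +ᶻ (negᶻ (⁺ 1) *ᶻ d +ᶻ ⁺ 0)))
      expand = solve-∀ᶻ

    Z≈z : Z ≈ₛ ⟦ z ⟧
    Z≈z k rewrite q^-cong {2 * n + 1} {n + suc n} (solve (n ∷ [])) k | ℕ.+-comm n 1 | q^-zero k =
      expand (q^ (n + suc n) k) (q^ (suc n) k) (q^ n k) (cst (⁺ 1) k)
      where
      expand : ∀ a b c d → a -ᶻ b -ᶻ c +ᶻ d
                           ≡ ⁺ 1 *ᶻ a +ᶻ (negᶻ (⁺ 1) *ᶻ b +ᶻ (negᶻ (⁺ 1) *ᶻ c +ᶻ (⁺ 1 *ᶻ d +ᶻ ⁺ 0)))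
      expand = solve-∀ᶻ

    raise-y : raise (2 + n) y ≡ (⁺ 2 , 4 + (n + suc n)) ∷ (⁺ 1 , 4 + n) ∷ (negᶻ (⁺ 2) , 3 + n) ∷ (negᶻ (⁺ 1) , 2 + n) ∷ []
    raise-y = cong₂ _∷_ (cong (⁺ 2 ,_) (solve (n ∷ [])))
             (cong₂ _∷_ (cong (⁺ 1 ,_) (solve (n ∷ [])))
             (cong₂ _∷_ (cong (negᶻ (⁺ 2) ,_) (solve (n ∷ [])))
             (cong₂ _∷_ (cong (negᶻ (⁺ 1) ,_) (solve (n ∷ []))) refl)))

  numer-expanded : numer n ≈ₛ ⟦ raise (2 + n) y ⟧ ⊖ ⟦ raise 1 y ⟧ ⊖ ⟦ raise 4 z ⟧
  numer-expanded = begin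
    q^ 1 ⊛ X ⊛ Y ⊖ q^ 4 ⊛ Z
      ≈⟨ ⊖-cong (λ k → trans (⊛-congˡ Y (q^-⊛ 1 X) k) (shift-⊛ X Y k)) (q^-⊛ 4 Z) ⟩
    shift (X ⊛ Y) ⊖ shiftⁿ 4 Z
      ≈⟨ ⊖-cong (shift-cong X⊛Y) (shiftⁿ-cong 4 Z≈z) ⟩
    shift (shiftⁿ (suc n) ⟦ y ⟧ ⊖ ⟦ y ⟧) ⊖ shiftⁿ 4 ⟦ z ⟧
      ≈⟨ ⊖-cong (λ k → trans (shiftⁿ-⊖ 1 (shiftⁿ (suc n) ⟦ y ⟧) ⟦ y ⟧ k)
                               (cong₂ _-ᶻ_ (shiftⁿ-⟦⟧ (2 + n) y k) (shiftⁿ-⟦⟧ 1 y k)))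
                (shiftⁿ-⟦⟧ 4 z) ⟩
    ⟦ raise (2 + n) y ⟧ ⊖ ⟦ raise 1 y ⟧ ⊖ ⟦ raise 4 z ⟧ ∎
    where
    open SeriesReasoning
    X : Series
    X = q^ (n + 1) ⊖ cst (⁺ 1)
    X⊛Y : X ⊛ Y ≈ₛ shiftⁿ (suc n) ⟦ y ⟧ ⊖ ⟦ y ⟧
    X⊛Y k = trans (⊛-distribʳ-⊖ (q^ (n + 1)) (cst (⁺ 1)) Y k)
      (cong₂ _-ᶻ_ (trans (⊛-congˡ Y (q^-cong (ℕ.+-comm n 1)) k) (trans (q^-⊛ (suc n) Y k) (shiftⁿ-cong (suc n) Y≈y k)))
                  (trans (one-⊛ Y k) (Y≈y k)))

  closed-forms : Series
  closed-forms = (q^ 0 ⊖ q^ m ⊖ q^ (suc m) ⊕ q^ (suc (m + m)))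
    ⊕ (q^ m ⊖ q^ (2 + m) ⊖ q^ (m + m) ⊕ q^ (2 + (m + m)))
    ⊕ (q^ 2 ⊖ q^ (2 + 2) ⊖ q^ (2 + m) ⊕ q^ (2 + (2 + m)))
    ⊖ (q^ 0 ⊖ q^ (1 + 0) ⊖ q^ (2 + 0) ⊕ q^ (3 + 0))
    ⊕ (q^ (m + m) ⊖ q^ (1 + (m + m)) ⊖ q^ (2 + (m + m)) ⊕ q^ (3 + (m + m)))
    where
    m : ℕ
    m = suc n

  Λ-geometric-sum : Λ (triangle (suc n) ⊕ geom (suc n) (suc n) ⊕ geom 2 (suc n) ⊖ q^ 0 ⊕ q^ (suc n + suc n)) ≈ₛ closed-forms
  Λ-geometric-sum = begin
    Λ (△ ⊕ G₁ ⊕ G₂ ⊖ q^ 0 ⊕ q^ (m + m))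
      ≈⟨ Λ-⊕ (△ ⊕ G₁ ⊕ G₂ ⊖ q^ 0) (q^ (m + m)) ⟩
    Λ (△ ⊕ G₁ ⊕ G₂ ⊖ q^ 0) ⊕ Λ (q^ (m + m))
      ≈⟨ ⊕-cong (λ k → trans (Λ-⊖ (△ ⊕ G₁ ⊕ G₂) (q^ 0) k)
                      (cong (_-ᶻ Λ (q^ 0) k) (trans (Λ-⊕ (△ ⊕ G₁) G₂ k) (cong (_+ᶻ Λ G₂ k) (Λ-⊕ △ G₁ k)))))
                (≈ₛ-refl (Λ (q^ (m + m)))) ⟩
    Λ △ ⊕ Λ G₁ ⊕ Λ G₂ ⊖ Λ (q^ 0) ⊕ Λ (q^ (m + m))
      ≈⟨ ⊕-cong (⊖-cong (⊕-cong (⊕-cong (Λ-triangle m) (Λ-geom m m)) (Λ-geom 2 m)) (Λ-q^ 0)) (Λ-q^ (m + m)) ⟩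
    closed-forms ∎
    where
    open SeriesReasoning
    m : ℕ
    m = suc n
    △ G₁ G₂ : Series
    △ = triangle m
    G₁ = geom m m
    G₂ = geom 2 m

  closed-forms≈numer : closed-forms ≈ₛ numer n
  closed-forms≈numer = begin
    closed-forms                                         ≈⟨ collect ⟩
    ⟦ y′ ⟧ ⊖ ⟦ raise 1 y ⟧ ⊖ ⟦ raise 4 z ⟧               ≈⟨ ⊖-cong (⊖-cong (λ k → cong (λ p → ⟦ p ⟧ k) (sym raise-y))
                                                                           (≈ₛ-refl ⟦ raise 1 y ⟧)) (≈ₛ-refl ⟦ raise 4 z ⟧) ⟩
    ⟦ raise (2 + n) y ⟧ ⊖ ⟦ raise 1 y ⟧ ⊖ ⟦ raise 4 z ⟧  ≈⟨ numer-expanded ⟨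
    numer n                                              ∎
    where
    open SeriesReasoning
    m : ℕ
    m = suc n
    y′ : List (ℤ × ℕ)
    y′ = (⁺ 2 , 4 + (n + suc n)) ∷ (⁺ 1 , 4 + n) ∷ (negᶻ (⁺ 2) , 3 + n) ∷ (negᶻ (⁺ 1) , 2 + n) ∷ []
    collect : closed-forms ≈ₛ ⟦ y′ ⟧ ⊖ ⟦ raise 1 y ⟧ ⊖ ⟦ raise 4 z ⟧
    collect k = identity (q^ 0 k) (q^ 1 k) (q^ 2 k) (q^ 3 k) (q^ 4 k)
      (q^ (1 + n) k) (q^ (2 + n) k) (q^ (3 + n) k) (q^ (4 + n) k) (q^ (5 + n) k)
      (q^ (m + m) k) (q^ (1 + (m + m)) k) (q^ (2 + (m + m)) k) (q^ (3 + (m + m)) k)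
      where
      identity : ∀ x₀ x₁ x₂ x₃ x₄ a₁ a₂ a₃ a₄ a₅ b₀ b₁ b₂ b₃ →
        (x₀ -ᶻ a₁ -ᶻ a₂ +ᶻ b₁) +ᶻ (a₁ -ᶻ a₃ -ᶻ b₀ +ᶻ b₂) +ᶻ (x₂ -ᶻ x₄ -ᶻ a₃ +ᶻ a₅)
          -ᶻ (x₀ -ᶻ x₁ -ᶻ x₂ +ᶻ x₃) +ᶻ (b₀ -ᶻ b₁ -ᶻ b₂ +ᶻ b₃)
        ≡ (⁺ 2 *ᶻ b₃ +ᶻ (⁺ 1 *ᶻ a₄ +ᶻ (negᶻ (⁺ 2) *ᶻ a₃ +ᶻ (negᶻ (⁺ 1) *ᶻ a₂ +ᶻ ⁺ 0))))
          -ᶻ (⁺ 2 *ᶻ a₄ +ᶻ (⁺ 1 *ᶻ x₃ +ᶻ (negᶻ (⁺ 2) *ᶻ x₂ +ᶻ (negᶻ (⁺ 1) *ᶻ x₁ +ᶻ ⁺ 0))))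
          -ᶻ (⁺ 1 *ᶻ b₃ +ᶻ (negᶻ (⁺ 1) *ᶻ a₅ +ᶻ (negᶻ (⁺ 1) *ᶻ a₄ +ᶻ (⁺ 1 *ᶻ x₄ +ᶻ ⁺ 0))))
      identity = solve-∀ᶻ

  geometric-identity :
    denom ⊛ (triangle (suc n) ⊕ geom (suc n) (suc n) ⊕ geom 2 (suc n) ⊖ cst (⁺ 1) ⊕ q^ (2 * n + 2)) ≈ₛ numer n
  geometric-identity = begin
    denom ⊛ G                                                                              ≈⟨ denom-⊛ G ⟩
    Λ G                                                                                    ≈⟨ Λ-cong G≈ ⟩
    Λ (triangle (suc n) ⊕ geom (suc n) (suc n) ⊕ geom 2 (suc n) ⊖ q^ 0 ⊕ q^ (suc n + suc n)) ≈⟨ Λ-geometric-sum ⟩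
    closed-forms                                                                           ≈⟨ closed-forms≈numer ⟩
    numer n                                                                                ∎
    where
    open SeriesReasoning
    G : Series
    G = triangle (suc n) ⊕ geom (suc n) (suc n) ⊕ geom 2 (suc n) ⊖ cst (⁺ 1) ⊕ q^ (2 * n + 2)
    G≈ : G ≈ₛ triangle (suc n) ⊕ geom (suc n) (suc n) ⊕ geom 2 (suc n) ⊖ q^ 0 ⊕ q^ (suc n + suc n)
    G≈ = ⊕-cong (⊖-cong (≈ₛ-refl (triangle (suc n) ⊕ geom (suc n) (suc n) ⊕ geom 2 (suc n))) (λ k → sym (q^-zero k)))
                (q^-cong ((2 * n + 2 ≡ suc n + suc n) ∋ solve (n ∷ [])))

-- Counting the solutions of k = e + 3j

steps3? : ℕ → ℕ → Maybe ℕ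
steps3? (suc e) (suc k) = steps3? e k
steps3? (suc e) zero = nothing
steps3? zero zero = just 0
steps3? zero (suc zero) = nothing
steps3? zero (suc (suc zero)) = nothing
steps3? zero (suc (suc (suc k))) = Maybe.map suc (steps3? zero k)

steps3?-sound : ∀ e k {j} → steps3? e k ≡ just j → k ≡ e + 3 * j
steps3?-sound (suc e) (suc k) eq = cong suc (steps3?-sound e k eq)
steps3?-sound zero zero refl = refl
steps3?-sound zero (suc (suc (suc k))) eq with steps3? zero k in eq′
steps3?-sound zero (suc (suc (suc k))) refl | just j =
  trans (cong (3 +_) (steps3?-sound zero k eq′)) (sym (ℕ.*-suc 3 j))

steps3?-complete : ∀ e j → steps3? e (e + 3 * j) ≡ just j
steps3?-complete (suc e) j = steps3?-complete e j
steps3?-complete zero zero = refl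
steps3?-complete zero (suc j) =
  subst (λ k → steps3? zero k ≡ just (suc j)) (sym (ℕ.*-suc 3 j)) (cong (Maybe.map suc) (steps3?-complete zero j))

-- hits e = Σⱼ q^(e + 3j) = q^e / (1 − q³).
hits : ℕ → Series
hits e k = maybe (λ _ → ⁺ 1) (⁺ 0) (steps3? e k)

oneMinusQ³-⊛ : ∀ f → (cst (⁺ 1) ⊖ q^ 3) ⊛ f ≈ₛ f ⊖ shiftⁿ 3 f
oneMinusQ³-⊛ f k = trans (⊛-distribʳ-⊖ (cst (⁺ 1)) (q^ 3) f k) (cong₂ _-ᶻ_ (one-⊛ f k) (q^-⊛ 3 f k))

hits-telescope : ∀ e → hits e ⊖ shiftⁿ 3 (hits e) ≈ₛ q^ e
hits-telescope zero zero = refl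
hits-telescope zero (suc zero) = refl
hits-telescope zero (suc (suc zero)) = refl
hits-telescope zero (suc (suc (suc k))) = cancel (steps3? zero k)
  where
  cancel : ∀ s → maybe (λ _ → ⁺ 1) (⁺ 0) (Maybe.map suc s) -ᶻ maybe (λ _ → ⁺ 1) (⁺ 0) s ≡ ⁺ 0
  cancel nothing = refl
  cancel (just _) = refl
hits-telescope (suc e) zero = refl
hits-telescope (suc e) (suc k) = begin
  hits e k -ᶻ shiftⁿ 3 (hits (suc e)) (suc k)  ≡⟨ cong (hits e k -ᶻ_) (shiftⁿ-cong 3 hits-suc (suc k)) ⟩
  hits e k -ᶻ shiftⁿ 3 (hits e) k               ≡⟨ hits-telescope e k ⟩
  q^ e k                                         ≡⟨ q^-suc e (suc k) ⟨
  q^ (suc e) (suc k)                             ∎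
  where
  open ≡-Reasoning
  hits-suc : hits (suc e) ≈ₛ shift (hits e)
  hits-suc zero = refl
  hits-suc (suc k) = refl

-- The Apéry set of S with respect to 3

data NotOneMod3 (n : ℕ) : Set where
  mod0 : ∀ t → n ≡ 3 * t → NotOneMod3 n
  mod2 : ∀ t → n ≡ 3 * t + 2 → NotOneMod3 n

notOneMod3 : ∀ n → n % 3 ≢ 1 → NotOneMod3 n
notOneMod3 n n%3≢1 = by-residue (n % 3) refl (m%n<n n 3)
  where
  by-residue : ∀ r → n % 3 ≡ r → r < 3 → NotOneMod3 n
  by-residue 0 n%3≡0 _ = mod0 (n / 3) (begin
    n                   ≡⟨ m≡m%n+[m/n]*n n 3 ⟩
    n % 3 + n / 3 * 3   ≡⟨ cong (_+ n / 3 * 3) n%3≡0 ⟩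
    n / 3 * 3           ≡⟨ ℕ.*-comm (n / 3) 3 ⟩
    3 * (n / 3)         ∎)
    where open ≡-Reasoning
  by-residue 1 n%3≡1 _ = ⊥-elim (n%3≢1 n%3≡1)
  by-residue 2 n%3≡2 _ = mod2 (n / 3) (begin
    n                   ≡⟨ m≡m%n+[m/n]*n n 3 ⟩
    n % 3 + n / 3 * 3   ≡⟨ cong (_+ n / 3 * 3) n%3≡2 ⟩
    2 + n / 3 * 3       ≡⟨ ℕ.+-comm 2 (n / 3 * 3) ⟩
    n / 3 * 3 + 2       ≡⟨ cong (_+ 2) (ℕ.*-comm (n / 3) 3) ⟩
    3 * (n / 3) + 2     ∎)
    where open ≡-Reasoning
  by-residue (suc (suc (suc r))) _ (s≤s (s≤s (s≤s ())))

data Apéry : Set where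
  w₀ w₁ w₂ : Apéry

Pos : Set
Pos = Apéry × ℕ

module _ (n : ℕ) where

  apery : Apéry → ℕ
  apery w₀ = 0
  apery w₁ = n + 2
  apery w₂ = 2 * n + 1

  elem : Pos → ℕ
  elem (c , j) = apery c + 3 * j

  add3 addA addB : Pos → Pos
  add3 (c , j) = c , suc j
  addA (w₀ , j) = w₁ , j
  addA (w₁ , j) = w₂ , suc j
  addA (w₂ , j) = w₀ , j + suc n
  addB (w₀ , j) = w₂ , j
  addB (w₁ , j) = w₀ , j + suc n
  addB (w₂ , j) = w₁ , j + n

  elem-add3 : ∀ p → elem p + 3 ≡ elem (add3 p)
  elem-add3 (c , j) = trans (ℕ.+-assoc (apery c) (3 * j) 3) (cong (apery c +_) (trans (ℕ.+-comm (3 * j) 3) (sym (ℕ.*-suc 3 j))))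

  elem-addA : ∀ p → elem p + (n + 2) ≡ elem (addA p)
  elem-addA (w₀ , j) = ℕ.+-comm (3 * j) (n + 2)
  elem-addA (w₁ , j) = (n + 2 + 3 * j + (n + 2) ≡ 2 * n + 1 + 3 * suc j) ∋ solve (n ∷ j ∷ [])
  elem-addA (w₂ , j) = (2 * n + 1 + 3 * j + (n + 2) ≡ 3 * (j + suc n)) ∋ solve (n ∷ j ∷ [])

  elem-addB : ∀ p → elem p + (2 * n + 1) ≡ elem (addB p)
  elem-addB (w₀ , j) = ℕ.+-comm (3 * j) (2 * n + 1)
  elem-addB (w₁ , j) = (n + 2 + 3 * j + (2 * n + 1) ≡ 3 * (j + suc n)) ∋ solve (n ∷ j ∷ [])
  elem-addB (w₂ , j) = (2 * n + 1 + 3 * j + (2 * n + 1) ≡ n + 2 + 3 * (j + n)) ∋ solve (n ∷ j ∷ [])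

  elem-∈S : ∀ p → InS n (elem p)
  elem-∈S (w₀ , j) = j , 0 , 0 , ((3 * j + (n + 2) * 0 + (2 * n + 1) * 0 ≡ 3 * j) ∋ solve (n ∷ j ∷ []))
  elem-∈S (w₁ , j) = j , 1 , 0 , ((3 * j + (n + 2) * 1 + (2 * n + 1) * 0 ≡ n + 2 + 3 * j) ∋ solve (n ∷ j ∷ []))
  elem-∈S (w₂ , j) = j , 0 , 1 , ((3 * j + (n + 2) * 0 + (2 * n + 1) * 1 ≡ 2 * n + 1 + 3 * j) ∋ solve (n ∷ j ∷ []))

  climb : (Q : Pos → Set) → (∀ p → Q p → Q (add3 p)) → (∀ p → Q p → Q (addA p)) → (∀ p → Q p → Q (addB p)) →
    ∀ {p} → Q p → ∀ a b c → Σ Pos λ p′ → (elem p′ ≡ elem p + 3 * a + (n + 2) * b + (2 * n + 1) * c) × Q p′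
  climb Q Q-add3 Q-addA Q-addB {p} Qp = go
    where
    go : ∀ a b c → Σ Pos λ p′ → (elem p′ ≡ elem p + 3 * a + (n + 2) * b + (2 * n + 1) * c) × Q p′
    go zero zero zero = p , no-steps n (elem p) , Qp
      where
      no-steps : ∀ n x → x ≡ x + 3 * 0 + (n + 2) * 0 + (2 * n + 1) * 0
      no-steps = solve-∀
    go (suc a) zero zero with go a zero zero
    ... | p′ , eq , Qp′ = add3 p′ , trans (sym (elem-add3 p′)) (trans (cong (_+ 3) eq) (step n (elem p) a)) , Q-add3 p′ Qp′
      where
      step : ∀ n x a → x + 3 * a + (n + 2) * 0 + (2 * n + 1) * 0 + 3 ≡ x + 3 * suc a + (n + 2) * 0 + (2 * n + 1) * 0
      step = solve-∀
    go a (suc b) zero with go a b zero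
    ... | p′ , eq , Qp′ = addA p′ , trans (sym (elem-addA p′)) (trans (cong (_+ (n + 2)) eq) (step n (elem p) a b)) , Q-addA p′ Qp′
      where
      step : ∀ n x a b → x + 3 * a + (n + 2) * b + (2 * n + 1) * 0 + (n + 2) ≡ x + 3 * a + (n + 2) * suc b + (2 * n + 1) * 0
      step = solve-∀
    go a b (suc c) with go a b c
    ... | p′ , eq , Qp′ = addB p′ , trans (sym (elem-addB p′)) (trans (cong (_+ (2 * n + 1)) eq) (step n (elem p) a b c)) , Q-addB p′ Qp′
      where
      step : ∀ n x a b c → x + 3 * a + (n + 2) * b + (2 * n + 1) * c + (2 * n + 1) ≡ x + 3 * a + (n + 2) * b + (2 * n + 1) * suc c
      step = solve-∀

  ∈S⇒elem : ∀ {x} → InS n x → ∃[ p ] elem p ≡ x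
  ∈S⇒elem (a , b , c , refl) with climb (λ _ → ⊤) (λ _ _ → tt) (λ _ _ → tt) (λ _ _ → tt) {w₀ , 0} tt a b c
  ... | p , eq , _ = p , eq

residue : ∀ {n} → NotOneMod3 n → Apéry → ℕ
residue _ w₀ = 0
residue (mod0 _ _) w₁ = 2
residue (mod0 _ _) w₂ = 1
residue (mod2 _ _) w₁ = 1
residue (mod2 _ _) w₂ = 2

residue<3 : ∀ {n} (shape : NotOneMod3 n) c → residue shape c < 3
residue<3 _ w₀ = s≤s z≤n
residue<3 (mod0 _ _) w₁ = s≤s (s≤s (s≤s z≤n))
residue<3 (mod0 _ _) w₂ = s≤s (s≤s z≤n)
residue<3 (mod2 _ _) w₁ = s≤s (s≤s z≤n)
residue<3 (mod2 _ _) w₂ = s≤s (s≤s (s≤s z≤n))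

apery≡3t+residue : ∀ {n} (shape : NotOneMod3 n) c → ∃[ t ] apery n c ≡ 3 * t + residue shape c
apery≡3t+residue _ w₀ = 0 , refl
apery≡3t+residue (mod0 t refl) w₁ = t , refl
apery≡3t+residue (mod0 t refl) w₂ = 2 * t , ((2 * (3 * t) + 1 ≡ 3 * (2 * t) + 1) ∋ solve (t ∷ []))
apery≡3t+residue (mod2 t refl) w₁ = suc t , ((3 * t + 2 + 2 ≡ 3 * suc t + 1) ∋ solve (t ∷ []))
apery≡3t+residue (mod2 t refl) w₂ = suc (2 * t) , ((2 * (3 * t + 2) + 1 ≡ 3 * suc (2 * t) + 2) ∋ solve (t ∷ []))

classOfResidue : ∀ {n} → NotOneMod3 n → ℕ → Apéry
classOfResidue (mod0 _ _) zero = w₀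
classOfResidue (mod0 _ _) (suc zero) = w₂
classOfResidue (mod0 _ _) (suc (suc _)) = w₁
classOfResidue (mod2 _ _) zero = w₀
classOfResidue (mod2 _ _) (suc zero) = w₁
classOfResidue (mod2 _ _) (suc (suc _)) = w₂

classOfResidue-residue : ∀ {n} (shape : NotOneMod3 n) c → classOfResidue shape (residue shape c) ≡ c
classOfResidue-residue (mod0 _ _) w₀ = refl
classOfResidue-residue (mod0 _ _) w₁ = refl
classOfResidue-residue (mod0 _ _) w₂ = refl
classOfResidue-residue (mod2 _ _) w₀ = refl
classOfResidue-residue (mod2 _ _) w₁ = refl
classOfResidue-residue (mod2 _ _) w₂ = refl

module _ {n : ℕ} (shape : NotOneMod3 n) where

  elem%3 : ∀ c j → elem n (c , j) % 3 ≡ residue shape c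
  elem%3 c j with apery≡3t+residue shape c
  ... | t , apery≡ = begin
    (apery n c + 3 * j) % 3                      ≡⟨ cong (λ a → (a + 3 * j) % 3) apery≡ ⟩
    (3 * t + residue shape c + 3 * j) % 3        ≡⟨ cong (_% 3) (regroup t j (residue shape c)) ⟩
    (residue shape c + (t + j) * 3) % 3          ≡⟨ [m+kn]%n≡m%n (residue shape c) (t + j) 3 ⟩
    residue shape c % 3                          ≡⟨ m<n⇒m%n≡m (residue<3 shape c) ⟩
    residue shape c                              ∎
    where
    open ≡-Reasoning
    regroup : ∀ t j r → 3 * t + r + 3 * j ≡ r + (t + j) * 3
    regroup = solve-∀

  classOf : ℕ → Apéry
  classOf x = classOfResidue shape (x % 3)

  classOf-elem : ∀ c j → classOf (elem n (c , j)) ≡ c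
  classOf-elem c j = trans (cong (classOfResidue shape) (elem%3 c j)) (classOfResidue-residue shape c)

  decode : ℕ → Maybe Pos
  decode x = Maybe.map (classOf x ,_) (steps3? (apery n (classOf x)) x)

  decode-elem : ∀ p → decode (elem n p) ≡ just p
  decode-elem (c , j) rewrite classOf-elem c j | steps3?-complete (apery n c) j = refl

  decode-sound : ∀ x {p} → decode x ≡ just p → elem n p ≡ x
  decode-sound x eq with steps3? (apery n (classOf x)) x in steps
  decode-sound x refl | just j = sym (steps3?-sound (apery n (classOf x)) x steps)

  elem-injective : ∀ {p p′} → elem n p ≡ elem n p′ → p ≡ p′
  elem-injective {p} {p′} eq =
    just-injective (trans (sym (decode-elem p)) (trans (cong decode eq) (decode-elem p′)))

-- Ideals of S and their threshold triples

Triple : Set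
Triple = ℕ × ℕ × ℕ

_at_ : Triple → Apéry → ℕ
(u , _ , _) at w₀ = u
(_ , v , _) at w₁ = v
(_ , _ , w) at w₂ = w

size : Triple → ℕ
size (u , v , w) = u + v + w

Above : Triple → Pos → Set
Above t (c , j) = t at c ≤ j

-- The thresholds t for which {w + 3j : j ≥ t(w)} is closed under adding n+2 and 2n+1 (see addA, addB).
Admissible : ℕ → Triple → Set
Admissible n (u , v , w) = (v ≤ u) × (w ≤ u) × (w ≤ suc v) × (u ≤ w + suc n) × (u ≤ v + suc n) × (v ≤ w + n)

above-add3 : ∀ {n} t p → Above t p → Above t (add3 n p)
above-add3 t p t≤j = ℕ.m≤n⇒m≤1+n t≤j

above-addA : ∀ {n t} → Admissible n t → ∀ p → Above t p → Above t (addA n p)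
above-addA (v≤u , _ , _ , _ , _ , _) (w₀ , j) u≤j = ℕ.≤-trans v≤u u≤j
above-addA (_ , _ , w≤1+v , _ , _ , _) (w₁ , j) v≤j = ℕ.≤-trans w≤1+v (s≤s v≤j)
above-addA {n} (_ , _ , _ , u≤w+1+n , _ , _) (w₂ , j) w≤j = ℕ.≤-trans u≤w+1+n (ℕ.+-monoˡ-≤ (suc n) w≤j)

above-addB : ∀ {n t} → Admissible n t → ∀ p → Above t p → Above t (addB n p)
above-addB (_ , w≤u , _ , _ , _ , _) (w₀ , j) u≤j = ℕ.≤-trans w≤u u≤j
above-addB {n} (_ , _ , _ , _ , u≤v+1+n , _) (w₁ , j) v≤j = ℕ.≤-trans u≤v+1+n (ℕ.+-monoˡ-≤ (suc n) v≤j)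
above-addB {n} (_ , _ , _ , _ , _ , v≤w+n) (w₂ , j) w≤j = ℕ.≤-trans v≤w+n (ℕ.+-monoˡ-≤ n w≤j)

codim-unique : ∀ {n I k k′} → Codim n I k → Codim n I k′ → k ≡ k′
codim-unique (L , refl , L! , L-spec) (L′ , refl , L′! , L′-spec) =
  unique-same-members⇒same-length L! L′! λ z →
    mk⇔ (Equivalence.from (L′-spec z) ∘ Equivalence.to (L-spec z)) (Equivalence.from (L-spec z) ∘ Equivalence.to (L′-spec z))

classes : List Apéry
classes = w₀ ∷ w₁ ∷ w₂ ∷ []

∈-classes : ∀ c → c ∈ classes
∈-classes w₀ = here refl
∈-classes w₁ = there (here refl)
∈-classes w₂ = there (there (here refl))

classes-unique : Unique classes
classes-unique = ((λ ()) All.∷ (λ ()) All.∷ All.[]) ∷ ((λ ()) All.∷ All.[]) ∷ All.[] ∷ []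

segment : Apéry → ℕ → List Pos
segment c k = map (c ,_) (downFrom k)

below : Triple → List Pos
below t = concatMap (λ c → segment c (t at c)) classes

∈-below⇔ : ∀ t p → p ∈ below t ⇔ proj₂ p < t at proj₁ p
∈-below⇔ t (c , j) = mk⇔ to from
  where
  to : (c , j) ∈ below t → j < t at c
  to p∈ with find (∈-concatMap⁻ (λ c → segment c (t at c)) {xs = classes} p∈)
  ... | c′ , _ , p∈segment with ∈-map⁻ (c′ ,_) p∈segment
  ... | j′ , j′∈ , refl = ∈-downFrom⁻ j′∈
  from : j < t at c → (c , j) ∈ below t
  from j<t = ∈-concatMap⁺ (λ c → segment c (t at c)) (lose (∈-classes c) (∈-map⁺ (c ,_) (∈-downFrom⁺ j<t)))

below-unique : ∀ t → Unique (below t)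
below-unique t = concatMap-unique (λ c → segment c (t at c)) proj₁ classes-unique segment-unique segment-class
  where
  segment-unique : ∀ c → Unique (segment c (t at c))
  segment-unique c = Unique.map⁺ (cong proj₂) (Unique.downFrom⁺ (t at c))
  segment-class : ∀ {c p} → c ∈ classes → p ∈ segment c (t at c) → proj₁ p ≡ c
  segment-class {c} _ p∈segment with ∈-map⁻ (c ,_) p∈segment
  ... | _ , _ , refl = refl

length-below : ∀ t → length (below t) ≡ size t
length-below t@(u , v , w) = begin
  length (segment w₀ u ++ segment w₁ v ++ segment w₂ w ++ [])                 ≡⟨ List.length-++ (segment w₀ u) ⟩
  length (segment w₀ u) + length (segment w₁ v ++ segment w₂ w ++ [])         ≡⟨ cong (length (segment w₀ u) +_) (List.length-++ (segment w₁ v)) ⟩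
  length (segment w₀ u) + (length (segment w₁ v) + length (segment w₂ w ++ [])) ≡⟨ cong₂ _+_ (length-segment w₀ u) (cong₂ _+_ (length-segment w₁ v) (trans (List.length-++ (segment w₂ w)) (cong (_+ 0) (length-segment w₂ w)))) ⟩
  u + (v + (w + 0))                                                 ≡⟨ solve (u ∷ v ∷ w ∷ []) ⟩
  u + v + w                                                         ∎
  where
  open ≡-Reasoning
  length-segment : ∀ c k → length (segment c k) ≡ k
  length-segment c k = trans (List.length-map (c ,_) (downFrom k)) (List.length-downFrom k)

Codim-cong : ∀ {n I J k} → (∀ x → I x ≡ J x) → Codim n I k → Codim n J k
Codim-cong I≗J (L , len , L! , spec) =
  L , len , L! , λ x → mk⇔ (λ x∈L → let x∈S , x∉I = Equivalence.to (spec x) x∈L in x∈S , trans (sym (I≗J x)) x∉I)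
                           (λ (x∈S , x∉J) → Equivalence.from (spec x) (x∈S , trans (I≗J x) x∉J))

module _ {n : ℕ} (shape : NotOneMod3 n) where

  idealOf : Triple → Subset
  idealOf t x = maybe (λ (c , j) → t at c ≤ᵇ j) false (decode shape x)

  idealOf-elem : ∀ t p → idealOf t (elem n p) ≡ (t at proj₁ p ≤ᵇ proj₂ p)
  idealOf-elem t p rewrite decode-elem shape p = refl

  idealOf-above : ∀ t p → Above t p → idealOf t (elem n p) ≡ true
  idealOf-above t (c , j) t≤j = trans (idealOf-elem t (c , j)) (≤⇒≤ᵇ-true t≤j)

  idealOf-below : ∀ t p → ¬ Above t p → idealOf t (elem n p) ≡ false
  idealOf-below t (c , j) t≰j = trans (idealOf-elem t (c , j)) (≰⇒≤ᵇ-false t≰j)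

  idealOf-true : ∀ t {x} → idealOf t x ≡ true → Σ Pos λ p → elem n p ≡ x × Above t p
  idealOf-true t {x} x∈I with decode shape x in decoded
  idealOf-true t {x} () | nothing
  idealOf-true t {x} x∈I | just (c , j) = (c , j) , decode-sound shape x decoded , ≤ᵇ-true⇒≤ x∈I

  idealOf-elem-true : ∀ t p → idealOf t (elem n p) ≡ true → Above t p
  idealOf-elem-true t p p∈I with idealOf-true t {elem n p} p∈I
  ... | p′ , elem≡ , above = subst (Above t) (elem-injective shape {p′} {p} elem≡) above

  idealOf-ideal : ∀ {t} → Admissible n t → IsIdeal n (idealOf t)
  idealOf-ideal {t} adm = ⊆S , (elem n (w₀ , t at w₀) , idealOf-above t (w₀ , t at w₀) ℕ.≤-refl) , closed
    where
    ⊆S : ∀ x → idealOf t x ≡ true → InS n x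
    ⊆S x x∈I with idealOf-true t x∈I
    ... | p , refl , _ = elem-∈S n p
    closed : ∀ x s → idealOf t x ≡ true → InS n s → idealOf t (x + s) ≡ true
    closed x s x∈I (a , b , c , refl) with idealOf-true t x∈I
    ... | p , refl , above with climb n (Above t) (above-add3 {n} t) (above-addA adm) (above-addB adm) {p} above a b c
    ... | p′ , elem≡ , above′ = subst (λ y → idealOf t y ≡ true) (trans elem≡ (regroup (elem n p))) (idealOf-above t p′ above′)
      where
      regroup : ∀ x → x + 3 * a + (n + 2) * b + (2 * n + 1) * c ≡ x + (3 * a + (n + 2) * b + (2 * n + 1) * c)
      regroup x = trans (ℕ.+-assoc (x + 3 * a) _ _) (trans (ℕ.+-assoc x _ _) (cong (x +_) (sym (ℕ.+-assoc (3 * a) _ _))))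

  idealOf-injective : ∀ {t t′} → (∀ x → idealOf t x ≡ idealOf t′ x) → t ≡ t′
  idealOf-injective {u , v , w} {u′ , v′ , w′} same = cong₂ _,_ (at-≡ w₀) (cong₂ _,_ (at-≡ w₁) (at-≡ w₂))
    where
    t t′ : Triple
    t = u , v , w
    t′ = u′ , v′ , w′
    at-≡ : ∀ c → t at c ≡ t′ at c
    at-≡ c = ℕ.≤-antisym
      (idealOf-elem-true t (c , t′ at c) (trans (same _) (idealOf-above t′ (c , t′ at c) ℕ.≤-refl)))
      (idealOf-elem-true t′ (c , t at c) (trans (sym (same _)) (idealOf-above t (c , t at c) ℕ.≤-refl)))

  idealOf-codim : ∀ t → Codim n (idealOf t) (size t)
  idealOf-codim t = map (elem n) (below t) , length-gaps , Unique.map⁺ (elem-injective shape) (below-unique t) , gaps-spec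
    where
    length-gaps : length (map (elem n) (below t)) ≡ size t
    length-gaps = trans (List.length-map (elem n) (below t)) (length-below t)
    gaps-spec : ∀ x → x ∈ map (elem n) (below t) ⇔ (InS n x × idealOf t x ≡ false)
    gaps-spec x = mk⇔ to from
      where
      to : x ∈ map (elem n) (below t) → InS n x × idealOf t x ≡ false
      to x∈ with ∈-map⁻ (elem n) x∈
      ... | p , p∈ , refl = elem-∈S n p , idealOf-below t p (ℕ.<⇒≱ (Equivalence.to (∈-below⇔ t p) p∈))
      from : InS n x × idealOf t x ≡ false → x ∈ map (elem n) (below t)
      from (x∈S , x∉I) with ∈S⇒elem n x∈S
      ... | p , refl = ∈-map⁺ (elem n) (Equivalence.from (∈-below⇔ t p) (ℕ.≰⇒> not-above))
        where
        not-above : ¬ Above t p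
        not-above above with () ← trans (sym (idealOf-above t p above)) x∉I

  module _ {I : Subset} (I-ideal : IsIdeal n I) where

    private
      In : Pos → Set
      In p = I (elem n p) ≡ true

      closed-under : ∀ {g} (move : Pos → Pos) → InS n g → (∀ p → elem n p + g ≡ elem n (move p)) → ∀ p → In p → In (move p)
      closed-under move g∈S elem-move p p∈I =
        subst (λ y → I y ≡ true) (elem-move p) (proj₂ (proj₂ I-ideal) (elem n p) _ p∈I g∈S)

      in-add3 : ∀ p → In p → In (add3 n p)
      in-add3 = closed-under (add3 n) (1 , 0 , 0 , ((3 * 1 + (n + 2) * 0 + (2 * n + 1) * 0 ≡ 3) ∋ solve (n ∷ []))) (elem-add3 n)
      in-addA : ∀ p → In p → In (addA n p)
      in-addA = closed-under (addA n) (0 , 1 , 0 , ((3 * 0 + (n + 2) * 1 + (2 * n + 1) * 0 ≡ n + 2) ∋ solve (n ∷ []))) (elem-addA n)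
      in-addB : ∀ p → In p → In (addB n p)
      in-addB = closed-under (addB n) (0 , 0 , 1 , ((3 * 0 + (n + 2) * 0 + (2 * n + 1) * 1 ≡ 2 * n + 1) ∋ solve (n ∷ []))) (elem-addB n)

      member-in-w₀ : Σ ℕ λ j → In (w₀ , j)
      member-in-w₀ with proj₁ (proj₂ I-ideal)
      ... | x , x∈I with ∈S⇒elem n (proj₁ I-ideal x x∈I)
      ... | (w₀ , j) , refl = j , x∈I
      ... | (w₁ , j) , refl = j + suc n , in-addB (w₁ , j) x∈I
      ... | (w₂ , j) , refl = j + suc n , in-addA (w₂ , j) x∈I

      member-in : ∀ c → Σ ℕ λ j → In (c , j)
      member-in w₀ = member-in-w₀
      member-in w₁ = proj₁ member-in-w₀ , in-addA (w₀ , proj₁ member-in-w₀) (proj₂ member-in-w₀)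
      member-in w₂ = proj₁ member-in-w₀ , in-addB (w₀ , proj₁ member-in-w₀) (proj₂ member-in-w₀)

      opaque
        least-in : ∀ c → Σ ℕ (Least (λ j → I (elem n (c , j))))
        least-in c = least (λ j → I (elem n (c , j))) (member-in c)

      threshold : Apéry → ℕ
      threshold c = proj₁ (least-in c)

      threshold-in : ∀ c → In (c , threshold c)
      threshold-in c = proj₁ (proj₂ (least-in c))

      threshold-≤ : ∀ c j → In (c , j) → threshold c ≤ j
      threshold-≤ c j c,j∈I = ℕ.≮⇒≥ not-below
        where
        not-below : ¬ j < threshold c
        not-below j<threshold with () ← trans (sym c,j∈I) (proj₂ (proj₂ (least-in c)) j<threshold)

      above-threshold : ∀ c j → threshold c ≤ j → In (c , j)
      above-threshold c j t≤j = subst (λ i → In (c , i)) (ℕ.m∸n+n≡m t≤j) (climb3 (j ∸ threshold c))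
        where
        climb3 : ∀ d → In (c , d + threshold c)
        climb3 zero = threshold-in c
        climb3 (suc d) = in-add3 (c , d + threshold c) (climb3 d)

    thresholds : Triple
    thresholds = threshold w₀ , threshold w₁ , threshold w₂

    thresholds-admissible : Admissible n thresholds
    thresholds-admissible =
        threshold-≤ w₁ _ (in-addA (w₀ , threshold w₀) (threshold-in w₀))
      , threshold-≤ w₂ _ (in-addB (w₀ , threshold w₀) (threshold-in w₀))
      , threshold-≤ w₂ _ (in-addA (w₁ , threshold w₁) (threshold-in w₁))
      , threshold-≤ w₀ _ (in-addA (w₂ , threshold w₂) (threshold-in w₂))
      , threshold-≤ w₀ _ (in-addB (w₁ , threshold w₁) (threshold-in w₁))
      , threshold-≤ w₁ _ (in-addB (w₂ , threshold w₂) (threshold-in w₂))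

    thresholds-at : ∀ c → thresholds at c ≡ threshold c
    thresholds-at w₀ = refl
    thresholds-at w₁ = refl
    thresholds-at w₂ = refl

    ideal≡idealOf : ∀ x → I x ≡ idealOf thresholds x
    ideal≡idealOf x with I x in x∈?I | idealOf thresholds x in x∈?T
    ... | true | true = refl
    ... | false | false = refl
    ... | true | false with ∈S⇒elem n (proj₁ I-ideal x x∈?I)
    ...   | p@(c , j) , refl
      with () ← trans (sym (idealOf-above thresholds p (subst (_≤ j) (sym (thresholds-at c)) (threshold-≤ c j x∈?I)))) x∈?T
    ideal≡idealOf x | false | true with idealOf-true thresholds x∈?T
    ... | (c , j) , refl , t≤j
      with () ← trans (sym (above-threshold c j (subst (_≤ j) (thresholds-at c) t≤j))) x∈?I

-- Admissible triples are translates of finitely many bases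

_+₃_ : Triple → ℕ → Triple
(u , v , w) +₃ j = u + j , v + j , w + j

size-+₃ : ∀ t j → size (t +₃ j) ≡ size t + 3 * j
size-+₃ (u , v , w) j = (u + j + (v + j) + (w + j) ≡ u + v + w + 3 * j) ∋ solve (u ∷ v ∷ w ∷ j ∷ [])

baseOf : Triple → Triple
baseOf (u , v , w) = u ∸ (v ⊓ w) , v ∸ (v ⊓ w) , w ∸ (v ⊓ w)

IsBase : ℕ → Triple → Set
IsBase n (r , v , zero) = v ≤ r × r ≤ suc n × v ≤ n
IsBase n (r , zero , suc zero) = 1 ≤ r × r ≤ suc n
IsBase n _ = ⊥

module _ {n : ℕ} where

  private
    +j≤j+ : ∀ {r} j → r ≤ suc n → r + j ≤ j + suc n
    +j≤j+ {r} j r≤1+n = ℕ.≤-trans (ℕ.+-monoˡ-≤ j r≤1+n) (ℕ.≤-reflexive (ℕ.+-comm (suc n) j))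

  base+₃-admissible : ∀ b → IsBase n b → ∀ j → Admissible n (b +₃ j)
  base+₃-admissible (r , v , zero) (v≤r , r≤1+n , v≤n) j =
      ℕ.+-monoˡ-≤ j v≤r
    , ℕ.m≤n+m j r
    , ℕ.m≤n⇒m≤1+n (ℕ.m≤n+m j v)
    , +j≤j+ j r≤1+n
    , ℕ.≤-trans (+j≤j+ j r≤1+n) (ℕ.+-monoˡ-≤ (suc n) (ℕ.m≤n+m j v))
    , ℕ.≤-trans (ℕ.+-monoˡ-≤ j v≤n) (ℕ.≤-reflexive (ℕ.+-comm n j))
  base+₃-admissible (r , zero , suc zero) (1≤r , r≤1+n) j =
      ℕ.m≤n+m j r
    , ℕ.+-monoˡ-≤ j 1≤r
    , ℕ.≤-refl
    , ℕ.m≤n⇒m≤1+n (+j≤j+ j r≤1+n)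
    , +j≤j+ j r≤1+n
    , ℕ.m≤n⇒m≤1+n (ℕ.m≤m+n j n)

  admissible⇒base+₃ : ∀ {t} → Admissible n t → ∃[ b ] ∃[ j ] IsBase n b × t ≡ b +₃ j
  admissible⇒base+₃ {u , v , w} (v≤u , w≤u , w≤1+v , u≤w+1+n , u≤v+1+n , v≤w+n) with w ≤? v
  ... | yes w≤v = (u ∸ w , v ∸ w , 0) , w , base , t≡
    where
    base : IsBase n (u ∸ w , v ∸ w , 0)
    base = ℕ.∸-monoˡ-≤ w v≤u , ℕ.m≤n+o⇒m∸n≤o u w u≤w+1+n , ℕ.m≤n+o⇒m∸n≤o v w v≤w+n
    t≡ : (u , v , w) ≡ (u ∸ w + w , v ∸ w + w , w)
    t≡ = cong₂ _,_ (sym (ℕ.m∸n+n≡m w≤u)) (cong (_, w) (sym (ℕ.m∸n+n≡m w≤v)))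
  ... | no w≰v with ℕ.≤-antisym w≤1+v (ℕ.≰⇒> w≰v)
  ...   | refl = (u ∸ v , 0 , 1) , v , base , t≡
    where
    base : IsBase n (u ∸ v , 0 , 1)
    base = ℕ.m+n≤o⇒m≤o∸n 1 w≤u , ℕ.m≤n+o⇒m∸n≤o u v u≤v+1+n
    t≡ : (u , v , suc v) ≡ (u ∸ v + v , v , suc v)
    t≡ = cong (_, v , suc v) (sym (ℕ.m∸n+n≡m v≤u))

  baseOf-+₃ : ∀ b j → IsBase n b → baseOf (b +₃ j) ≡ b
  baseOf-+₃ (r , v , zero) j _
    rewrite ℕ.m≥n⇒m⊓n≡n (ℕ.m≤n+m j v) | ℕ.m+n∸n≡m r j | ℕ.m+n∸n≡m v j | ℕ.n∸n≡0 j = refl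
  baseOf-+₃ (r , zero , suc zero) j _
    rewrite ℕ.m≤n⇒m⊓n≡m (ℕ.n≤1+n j) | ℕ.m+n∸n≡m r j | ℕ.n∸n≡0 j | ℕ.m+n∸n≡m 1 j = refl

module _ (n : ℕ) where

  lowerRows topRow column bases : List Triple
  lowerRows = concatMap (λ r → map (λ v → r , v , 0) (downFrom (suc r))) (downFrom (suc n))
  topRow = map (λ v → suc n , v , 0) (downFrom (suc n))
  column = map (λ s → suc s , 0 , 1) (downFrom (suc n))
  bases = lowerRows ++ topRow ++ column

  ∈-bases⁻ : ∀ {b} → b ∈ bases → IsBase n b
  ∈-bases⁻ b∈ with ∈-++⁻ lowerRows b∈
  ... | inj₁ b∈lower with find (∈-concatMap⁻ (λ r → map (λ v → r , v , 0) (downFrom (suc r))) {xs = downFrom (suc n)} b∈lower)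
  ...   | r , r∈ , b∈row with ∈-map⁻ (λ v → r , v , 0) b∈row
  ...     | v , v∈ , refl = v≤r , ℕ.m≤n⇒m≤1+n r≤n , ℕ.≤-trans v≤r r≤n
    where
    r≤n : r ≤ n
    r≤n = ℕ.≤-pred (∈-downFrom⁻ r∈)
    v≤r : v ≤ r
    v≤r = ℕ.≤-pred (∈-downFrom⁻ v∈)
  ∈-bases⁻ b∈ | inj₂ b∈rest with ∈-++⁻ topRow b∈rest
  ... | inj₁ b∈top with ∈-map⁻ (λ v → suc n , v , 0) b∈top
  ...   | v , v∈ , refl = ℕ.m≤n⇒m≤1+n (ℕ.≤-pred (∈-downFrom⁻ v∈)) , ℕ.≤-refl , ℕ.≤-pred (∈-downFrom⁻ v∈)
  ∈-bases⁻ b∈ | inj₂ b∈rest | inj₂ b∈column with ∈-map⁻ (λ s → suc s , 0 , 1) b∈column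
  ... | s , s∈ , refl = s≤s z≤n , ∈-downFrom⁻ s∈

  ∈-bases⁺ : ∀ b → IsBase n b → b ∈ bases
  ∈-bases⁺ (r , v , zero) (v≤r , r≤1+n , v≤n) with ℕ.m≤n⇒m<n∨m≡n r≤1+n
  ... | inj₁ r<1+n = ∈-++⁺ˡ (∈-concatMap⁺ (λ r → map (λ v → r , v , 0) (downFrom (suc r)))
                              (lose (∈-downFrom⁺ r<1+n) (∈-map⁺ (λ v → r , v , 0) (∈-downFrom⁺ (s≤s v≤r)))))
  ... | inj₂ refl = ∈-++⁺ʳ lowerRows (∈-++⁺ˡ (∈-map⁺ (λ v → suc n , v , 0) (∈-downFrom⁺ (s≤s v≤n))))
  ∈-bases⁺ (suc s , zero , suc zero) (_ , s<1+n) =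
    ∈-++⁺ʳ lowerRows (∈-++⁺ʳ topRow (∈-map⁺ (λ s → suc s , 0 , 1) (∈-downFrom⁺ s<1+n)))

  bases-unique : Unique bases
  bases-unique = Unique.++⁺ lowerRows-unique (Unique.++⁺ topRow-unique column-unique top∩column) lower∩rest
    where
    lowerRows-unique : Unique lowerRows
    lowerRows-unique = concatMap-unique _ proj₁ (Unique.downFrom⁺ (suc n))
      (λ r → Unique.map⁺ (cong (proj₁ ∘ proj₂)) (Unique.downFrom⁺ (suc r)))
      λ {r} _ b∈row → case-row r b∈row
      where
      case-row : ∀ r {b} → b ∈ map (λ v → r , v , 0) (downFrom (suc r)) → proj₁ b ≡ r
      case-row r b∈row with ∈-map⁻ (λ v → r , v , 0) b∈row
      ... | _ , _ , refl = refl
    topRow-unique : Unique topRow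
    topRow-unique = Unique.map⁺ (cong (proj₁ ∘ proj₂)) (Unique.downFrom⁺ (suc n))
    column-unique : Unique column
    column-unique = Unique.map⁺ (cong (pred ∘ proj₁)) (Unique.downFrom⁺ (suc n))
    top∩column : ∀ {b} → b ∈ topRow × b ∈ column → ⊥
    top∩column (b∈top , b∈column) with ∈-map⁻ (λ v → suc n , v , 0) b∈top | ∈-map⁻ (λ s → suc s , 0 , 1) b∈column
    ... | _ , _ , refl | _ , _ , ()
    lowerRow-shape : ∀ {b} → b ∈ lowerRows → proj₁ b ≤ n × proj₂ (proj₂ b) ≡ 0
    lowerRow-shape b∈lower with find (∈-concatMap⁻ (λ r → map (λ v → r , v , 0) (downFrom (suc r))) {xs = downFrom (suc n)} b∈lower)
    ... | r , r∈ , b∈row with ∈-map⁻ (λ v → r , v , 0) b∈row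
    ...   | _ , _ , refl = ℕ.≤-pred (∈-downFrom⁻ r∈) , refl
    lower∩rest : ∀ {b} → b ∈ lowerRows × b ∈ topRow ++ column → ⊥
    lower∩rest (b∈lower , b∈rest) with lowerRow-shape b∈lower | ∈-++⁻ topRow b∈rest
    ... | r≤n , refl | inj₁ b∈top with ∈-map⁻ (λ v → suc n , v , 0) b∈top
    ...   | _ , _ , eq = ℕ.<-irrefl refl (subst (_≤ n) (cong proj₁ eq) r≤n)
    lower∩rest (b∈lower , b∈rest) | r≤n , refl | inj₂ b∈column with ∈-map⁻ (λ s → suc s , 0 , 1) b∈column
    ... | _ , _ , ()

translates : ℕ → Triple → List Triple
translates k b = maybe (λ j → [ b +₃ j ]) [] (steps3? (size b) k)

∈-translates⁻ : ∀ k b {t} → t ∈ translates k b → ∃[ j ] t ≡ b +₃ j × size b + 3 * j ≡ k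
∈-translates⁻ k b t∈ with steps3? (size b) k in steps
∈-translates⁻ k b (here refl) | just j = j , refl , sym (steps3?-sound (size b) k steps)

∈-translates⁺ : ∀ b j → b +₃ j ∈ translates (size b + 3 * j) b
∈-translates⁺ b j rewrite steps3?-complete (size b) j = here refl

translates-unique : ∀ k b → Unique (translates k b)
translates-unique k b with steps3? (size b) k
... | just _ = All.[] ∷ []
... | nothing = []

length-translates : ∀ k b → ⁺ length (translates k b) ≡ hits (size b) k
length-translates k b with steps3? (size b) k
... | just _ = refl
... | nothing = refl

admissibleOfSize : ℕ → ℕ → List Triple
admissibleOfSize n k = concatMap (translates k) (bases n)

module _ {n : ℕ} where

  ∈-admissibleOfSize⁻ : ∀ {k t} → t ∈ admissibleOfSize n k → Admissible n t × size t ≡ k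
  ∈-admissibleOfSize⁻ {k} t∈ with find (∈-concatMap⁻ (translates k) {xs = bases n} t∈)
  ... | b , b∈ , t∈translates with ∈-translates⁻ k b t∈translates
  ...   | j , refl , size≡k = base+₃-admissible b (∈-bases⁻ n b∈) j , trans (size-+₃ b j) size≡k

  ∈-admissibleOfSize⁺ : ∀ {t} → Admissible n t → t ∈ admissibleOfSize n (size t)
  ∈-admissibleOfSize⁺ adm with admissible⇒base+₃ adm
  ... | b , j , base , refl = ∈-concatMap⁺ (translates _) (lose (∈-bases⁺ n b base)
          (subst (λ k → b +₃ j ∈ translates k b) (sym (size-+₃ b j)) (∈-translates⁺ b j)))

  admissibleOfSize-unique : ∀ k → Unique (admissibleOfSize n k)
  admissibleOfSize-unique k = concatMap-unique (translates k) baseOf (bases-unique n) (translates-unique k) base-inv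
    where
    base-inv : ∀ {b t} → b ∈ bases n → t ∈ translates k b → baseOf t ≡ b
    base-inv {b} b∈ t∈ with ∈-translates⁻ k b t∈
    ... | j , refl , _ = baseOf-+₃ b j (∈-bases⁻ n b∈)

count : ℕ → ℕ → ℕ
count n k = length (admissibleOfSize n k)

idealCount : ∀ {n} → NotOneMod3 n → ∀ k → IdealCount n k (count n k)
idealCount {n} shape k = idealOf shape ∘ listed , listed-ideal , listed-injective , listed-complete
  where
  listed : Fin (count n k) → Triple
  listed = lookup (admissibleOfSize n k)
  listed-ideal : ∀ i → IsIdeal n (idealOf shape (listed i)) × Codim n (idealOf shape (listed i)) k
  listed-ideal i with ∈-admissibleOfSize⁻ {n} (∈-lookup {xs = admissibleOfSize n k} i)
  ... | adm , size≡k = idealOf-ideal shape adm , subst (Codim n _) size≡k (idealOf-codim shape (listed i))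
  listed-injective : ∀ i j → (∀ x → idealOf shape (listed i) x ≡ idealOf shape (listed j) x) → i ≡ j
  listed-injective i j same = lookup-injective (admissibleOfSize-unique {n} k) i j (idealOf-injective shape same)
  listed-complete : ∀ I → IsIdeal n I → Codim n I k → ∃[ i ] (∀ x → I x ≡ idealOf shape (listed i) x)
  listed-complete I I-ideal codim = index t∈ , λ x → trans (ideal≡idealOf shape I-ideal x) (cong (λ t → idealOf shape t x) (lookup-index t∈))
    where
    t : Triple
    t = thresholds shape I-ideal
    size≡k : size t ≡ k
    size≡k = codim-unique {n} (Codim-cong {n} {J = I} (λ x → sym (ideal≡idealOf shape I-ideal x)) (idealOf-codim shape t)) codim
    t∈ : t ∈ admissibleOfSize n k
    t∈ = subst (λ k → t ∈ admissibleOfSize n k) size≡k (∈-admissibleOfSize⁺ (thresholds-admissible shape I-ideal))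

sumBySize : (ℕ → Series) → List Triple → Series
sumBySize f [] = 0ₛ
sumBySize f (b ∷ bs) = f (size b) ⊕ sumBySize f bs

sumBySize-++ : ∀ f xs ys → sumBySize f (xs ++ ys) ≈ₛ sumBySize f xs ⊕ sumBySize f ys
sumBySize-++ f [] ys k = sym (ℤ.+-identityˡ _)
sumBySize-++ f (x ∷ xs) ys k =
  trans (cong (f (size x) k +ᶻ_) (sumBySize-++ f xs ys k)) (sym (ℤ.+-assoc (f (size x) k) _ _))

count≈sumBySize-hits : ∀ n → (λ k → ⁺ count n k) ≈ₛ sumBySize hits (bases n)
count≈sumBySize-hits n k = go (bases n)
  where
  go : ∀ bs → ⁺ length (concatMap (translates k) bs) ≡ sumBySize hits bs k
  go [] = refl
  go (b ∷ bs) = begin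
    ⁺ length (translates k b ++ concatMap (translates k) bs)              ≡⟨ cong ⁺_ (List.length-++ (translates k b)) ⟩
    ⁺ (length (translates k b) + length (concatMap (translates k) bs))    ≡⟨ ℤ.pos-+ (length (translates k b)) _ ⟩
    ⁺ length (translates k b) +ᶻ ⁺ length (concatMap (translates k) bs)  ≡⟨ cong₂ _+ᶻ_ (length-translates k b) (go bs) ⟩
    hits (size b) k +ᶻ sumBySize hits bs k                                ∎
    where open ≡-Reasoning

sumBySize-hits-telescope : ∀ bs → sumBySize hits bs ⊖ shiftⁿ 3 (sumBySize hits bs) ≈ₛ sumBySize q^ bs
sumBySize-hits-telescope [] k = cong (⁺ 0 -ᶻ_) (shiftⁿ-0ₛ 3 k)
sumBySize-hits-telescope (b ∷ bs) k = begin
  (h ⊕ S) k -ᶻ shiftⁿ 3 (h ⊕ S) k                       ≡⟨ cong ((h ⊕ S) k -ᶻ_) (shiftⁿ-⊕ 3 h S k) ⟩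
  (h k +ᶻ S k) -ᶻ (shiftⁿ 3 h k +ᶻ shiftⁿ 3 S k)        ≡⟨ interchange-- (h k) (S k) (shiftⁿ 3 h k) (shiftⁿ 3 S k) ⟩
  (h k -ᶻ shiftⁿ 3 h k) +ᶻ (S k -ᶻ shiftⁿ 3 S k)        ≡⟨ cong₂ _+ᶻ_ (hits-telescope (size b) k) (sumBySize-hits-telescope bs k) ⟩
  q^ (size b) k +ᶻ sumBySize q^ bs k                      ∎
  where
  open ≡-Reasoning
  h S : Series
  h = hits (size b)
  S = sumBySize hits bs
  interchange-- : ∀ a b c d → (a +ᶻ b) -ᶻ (c +ᶻ d) ≡ (a -ᶻ c) +ᶻ (b -ᶻ d)
  interchange-- = solve-∀ᶻ

bases-generating : ∀ n → sumBySize q^ (bases n) ≈ₛ triangle (suc n) ⊕ geom (suc n) (suc n) ⊕ geom 2 (suc n)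
bases-generating n = begin
  sumBySize q^ (lowerRows n ++ topRow n ++ column n)
    ≈⟨ sumBySize-++ q^ (lowerRows n) (topRow n ++ column n) ⟩
  sumBySize q^ (lowerRows n) ⊕ sumBySize q^ (topRow n ++ column n)
    ≈⟨ ⊕-cong (lower-sum (suc n)) (sumBySize-++ q^ (topRow n) (column n)) ⟩
  triangle (suc n) ⊕ (sumBySize q^ (topRow n) ⊕ sumBySize q^ (column n))
    ≈⟨ ⊕-cong (≈ₛ-refl (triangle (suc n))) (⊕-cong (row-sum (suc n) (suc n)) (column-sum (suc n))) ⟩
  triangle (suc n) ⊕ (geom (suc n) (suc n) ⊕ geom 2 (suc n))
    ≈⟨ (λ k → sym (ℤ.+-assoc (triangle (suc n) k) _ _)) ⟩
  triangle (suc n) ⊕ geom (suc n) (suc n) ⊕ geom 2 (suc n) ∎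
  where
  open SeriesReasoning
  row-sum : ∀ r m → sumBySize q^ (map (λ v → r , v , 0) (downFrom m)) ≈ₛ geom r m
  row-sum r zero = ≈ₛ-refl 0ₛ
  row-sum r (suc m) = ⊕-cong (q^-cong (ℕ.+-identityʳ (r + m))) (row-sum r m)
  lower-sum : ∀ m → sumBySize q^ (concatMap (λ r → map (λ v → r , v , 0) (downFrom (suc r))) (downFrom m)) ≈ₛ triangle m
  lower-sum zero = ≈ₛ-refl 0ₛ
  lower-sum (suc m) k = trans (sumBySize-++ q^ (map (λ v → m , v , 0) (downFrom (suc m))) _ k)
                          (cong₂ _+ᶻ_ (row-sum m (suc m) k) (lower-sum m k))
  column-sum : ∀ m → sumBySize q^ (map (λ s → suc s , 0 , 1) (downFrom m)) ≈ₛ geom 2 m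
  column-sum zero = ≈ₛ-refl 0ₛ
  column-sum (suc m) = ⊕-cong (q^-cong ((suc m + 0 + 1 ≡ 2 + m) ∋ solve (m ∷ []))) (column-sum m)

count-generating : ∀ n → (cst (⁺ 1) ⊖ q^ 3) ⊛ (λ k → ⁺ count n k) ≈ₛ sumBySize q^ (bases n)
count-generating n = begin
  (cst (⁺ 1) ⊖ q^ 3) ⊛ (λ k → ⁺ count n k)                          ≈⟨ oneMinusQ³-⊛ (λ k → ⁺ count n k) ⟩
  (λ k → ⁺ count n k) ⊖ shiftⁿ 3 (λ k → ⁺ count n k)                ≈⟨ ⊖-cong (count≈sumBySize-hits n) (shiftⁿ-cong 3 (count≈sumBySize-hits n)) ⟩
  sumBySize hits (bases n) ⊖ shiftⁿ 3 (sumBySize hits (bases n))    ≈⟨ sumBySize-hits-telescope (bases n) ⟩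
  sumBySize q^ (bases n)                                            ∎
  where open SeriesReasoning

-- The argument works for every n ≢ 1 (mod 3), including n = 0.
theorem4p4 : (n : ℕ) → 1 ≤ n → n % 3 ≢ 1 →
    Σ (ℕ → ℕ) λ a → (∀ k → IdealCount n k (a k)) ×
      (∃[ H ] (denom ⊛ H ≈ₛ numer n) ×
        ((cst (⁺ 1) ⊖ q^ 3) ⊛ (λ k → ⁺ (a k)) ≈ₛ
          (cst (⁺ 1) ⊕ H ⊖ q^ (2 * n + 2))))
theorem4p4 n _ n%3≢1 = count n , idealCount (notOneMod3 n n%3≢1) , H , denom⊛H , generating-function
  where
  P H : Series
  P = sumBySize q^ (bases n)
  H = P ⊖ cst (⁺ 1) ⊕ q^ (2 * n + 2)
  denom⊛H : denom ⊛ H ≈ₛ numer n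
  denom⊛H k = trans (⊛-congʳ denom (⊕-cong (⊖-cong (bases-generating n) (≈ₛ-refl (cst (⁺ 1)))) (≈ₛ-refl (q^ (2 * n + 2)))) k)
                    (geometric-identity n k)
  generating-function : (cst (⁺ 1) ⊖ q^ 3) ⊛ (λ k → ⁺ count n k) ≈ₛ cst (⁺ 1) ⊕ H ⊖ q^ (2 * n + 2)
  generating-function k = trans (count-generating n k) (cancel (P k) (cst (⁺ 1) k) (q^ (2 * n + 2) k))
    where
    cancel : ∀ p c x → p ≡ c +ᶻ (p -ᶻ c +ᶻ x) -ᶻ x
    cancel = solve-∀ᶻ
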